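{- Let $k\ge1$ be an integer with prime factorization $k=p_1^{a_1}\cdots p_r^{a_r}$ ($p_1,\dots,p_r$ distinct primes). Suppose that $$L_{D_k}(t)=q_1(t^{p_1})\cdots q_r(t^{p_r})\,L_{D_1}(t)$$ for some polynomials $q_1,\dots,q_r\in\mathbb{Z}[t]$. Then $G_m^{(k)}=G_m^{(1)}$ for every positive integer $m$ with $\gcd(k,m)=1$.
   Context: For $k\ge1$, $D_k$ is the smooth projective (absolutely irreducible) curve over $\mathbb{F}_2$ birational to the affine curve $y^2+y=x^{2^k+1}+x^{ -1}$, and $L_{D_k}(t)\in\mathbb{Z}[t]$ is its L-polynomial over $\mathbb{F}_2$, defined by $\exp\left(\sum_{n\ge1}\#D_k(\mathbb{F}_{2^n})\frac{t^n}{n}\right)=\frac{L_{D_k}(t)}{(1-t)(1-2t)}$. For $m\ge1$, $G_m^{(k)}=\sum_{x\in\mathbb{F}_{2^m}^*}(-1)^{\mathrm{Tr}_m(x^{2^k+1}+x^{ -1})}$, where $\mathrm{Tr}_m$ is the trace from $\mathbb{F}_{2^m}$ to $\mathbb{F}_2$. -}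

module Defs where

open import Data.Bool using (Bool; true; false; if_then_else_; _xor_)
open import Data.Bool.Properties using () renaming (_≟_ to _≟B_)
open import Data.Nat as ℕ using (ℕ; zero; suc; _∸_; _^_)
open import Data.Integer as ℤ using (ℤ; +_; 0ℤ; 1ℤ)
open import Data.List as L using (List; []; _∷_; filter; length; cartesianProduct; map; replicate; _++_; foldr)
open import Data.Vec as V using (Vec; []; _∷_; head; last; init; zipWith; toList)
open import Data.Vec.Properties using (≡-dec)
open import Data.Product using (Σ; _×_; _,_; proj₁; proj₂; ∃)
open import Data.Fin using (Fin)
open import Relation.Binary.PropositionalEquality using (_≡_; _≢_)
open import Relation.Nullary using (¬?)
open import Relation.Nullary.Decidable using (Dec)

-- A concrete model of F_{2^m}, m = suc n : F_2[x]/(x^m + f(x)),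
-- where  f : Vec Bool m  lists the coefficients of 1, x, ..., x^{m-1}
-- of the lower-order part of the monic modulus.  Elements are
-- coefficient vectors (c_0, ..., c_{m-1}).

F : ℕ → Set
F n = Vec Bool (suc n)

_≟F_ : ∀ {n} (a b : F n) → Dec (a ≡ b)
_≟F_ = ≡-dec _≟B_

zeroF : ∀ {n} → F n
zeroF = V.replicate _ false

oneF : ∀ {n} → F n
oneF = true ∷ V.replicate _ false

addF : ∀ {n} → F n → F n → F n
addF = zipWith _xor_

mulX : ∀ {n} → F n → F n → F n
mulX f v = if last v then addF (false ∷ init v) f else (false ∷ init v)

mulAux : ∀ {n} → F n → F n → List Bool → F n
mulAux f a []       = zeroF
mulAux f a (b ∷ bs) = addF (if b then a else zeroF) (mulAux f (mulX f a) bs)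

mulF : ∀ {n} → F n → F n → F n → F n
mulF f a b = mulAux f a (toList b)

powF : ∀ {n} → F n → F n → ℕ → F n
powF f a zero    = oneF
powF f a (suc e) = mulF f a (powF f a e)

-- the modulus defines a field: every nonzero element is invertible
-- (equivalently, x^m + f(x) is irreducible over F_2)
IsFieldModulus : ∀ {n} → F n → Set
IsFieldModulus {n} f = ∀ (a : F n) → a ≢ zeroF → ∃ λ b → mulF f a b ≡ oneF

invF : ∀ {n} → F n → F n → F n
invF {n} f a = powF f a (2 ^ suc n ∸ 2)

-- absolute trace Tr_m(a) = a + a^2 + ... + a^{2^{m-1}} ∈ F_2 ⊆ F_{2^m};
-- returned as a bit (the constant coefficient of that element of F_2)
traceSum : ∀ {n} → F n → F n → ℕ → F n
traceSum f a zero    = zeroF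
traceSum f a (suc i) = addF (powF f a (2 ^ i)) (traceSum f a i)

trF : ∀ {n} → F n → F n → Bool
trF {n} f a = head (traceSum f a (suc n))

allVecs : (m : ℕ) → List (Vec Bool m)
allVecs zero    = [] ∷ []
allVecs (suc m) = L.map (false ∷_) (allVecs m) ++ L.map (true ∷_) (allVecs m)

allF : (n : ℕ) → List (F n)
allF n = allVecs (suc n)

nonzeroF : (n : ℕ) → List (F n)
nonzeroF n = filter (λ a → ¬? (a ≟F zeroF)) (allF n)

rhs : ∀ {n} → F n → ℕ → F n → F n
rhs f k a = addF (powF f a (2 ^ k ℕ.+ 1)) (invF f a)

sign : Bool → ℤ
sign false = 1ℤ
sign true  = ℤ.- 1ℤ

-- G_m^{(k)} with m = suc n, computed in the model F_2[x]/(x^m + f)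
G : ∀ {n} → F n → ℕ → ℤ
G {n} f k = foldr ℤ._+_ 0ℤ (L.map (λ a → sign (trF f (rhs f k a))) (nonzeroF n))

-- Affine points (x,y) with x ≠ 0 and y^2 + y = x^{2^k+1} + x^{-1}, plus the
-- two places above x = 0 and x = ∞ (each totally ramified and rational,
-- the poles there having odd orders 1 and 2^k+1).

affinePoints : ∀ {n} → F n → ℕ → ℕ
affinePoints {n} f k =
  length (filter (λ p → addF (mulF f (proj₂ p) (proj₂ p)) (proj₂ p) ≟F rhs f k (proj₁ p))
                 (cartesianProduct (nonzeroF n) (allF n)))

pointCount : ∀ {n} → F n → ℕ → ℕ
pointCount f k = affinePoints f k ℕ.+ 2

-- Integer polynomials as coefficient lists (constant term first).

Poly : Set
Poly = List ℤ

coeff : Poly → ℕ → ℤ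
coeff []       _       = 0ℤ
coeff (c ∷ cs) zero    = c
coeff (c ∷ cs) (suc i) = coeff cs i

addP : Poly → Poly → Poly
addP []       q        = q
addP p        []       = p
addP (a ∷ as) (b ∷ bs) = (a ℤ.+ b) ∷ addP as bs

mulP : Poly → Poly → Poly
mulP []       q = []
mulP (c ∷ cs) q = addP (L.map (c ℤ.*_) q) (0ℤ ∷ mulP cs q)

-- q(t) ↦ q(t^p)   (for p ≥ 1)
expand : ℕ → Poly → Poly
expand p []       = []
expand p (c ∷ cs) = c ∷ (replicate (p ∸ 1) 0ℤ ++ expand p cs)

prodFin : ∀ {r} → (Fin r → Poly) → Poly
prodFin {zero}  g = 1ℤ ∷ []
prodFin {suc r} g = mulP (g Fin.zero) (prodFin (λ i → g (Fin.suc i)))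
  where import Data.Fin as Fin

-- equality of polynomials (coefficientwise, ignoring trailing zeros)
_≈P_ : Poly → Poly → Set
p ≈P q = ∀ i → coeff p i ≡ coeff q i

Σ< : ℕ → (ℕ → ℤ) → ℤ
Σ< zero    g = 0ℤ
Σ< (suc n) g = Σ< n g ℤ.+ g n

-- A family of field models: fam n is a modulus for
-- F_{2^{n+1}}.  With N_j = #D_k(F_{2^j}) and a_j = N_j - 1 - 2^j,
--   exp(Σ N_j t^j / j) = L(t) / ((1-t)(1-2t))
-- is equivalent (taking t·d/dt log) to
--   c_0 = 1  and  j c_j = Σ_{i=1}^{j} a_i c_{j-i}  for all j ≥ 1.

FieldFamily : Set
FieldFamily = Σ ((n : ℕ) → F n) (λ fam → ∀ n → IsFieldModulus (fam n))

-- a_{j+1} for D_k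
traceTerm : FieldFamily → ℕ → ℕ → ℤ
traceTerm (fam , _) k j =
  (+ pointCount (fam j) k) ℤ.- 1ℤ ℤ.- (+ (2 ^ suc j))

IsLPolynomial : FieldFamily → ℕ → Poly → Set
IsLPolynomial ff k L =
  (coeff L 0 ≡ 1ℤ) ×
  (∀ n → (+ suc n) ℤ.* coeff L (suc n)
           ≡ Σ< (suc n) (λ j → traceTerm ff k j ℤ.* coeff L (n ∸ j)))

{-# OPTIONS --safe #-}
module Submission where

open import Defs
open import Data.Nat using (ℕ; suc; _≤_)
open import Data.Nat.Divisibility using (_∣_)
open import Data.Nat.GCD using (gcd)
open import Data.Nat.Primality using (Prime)
open import Data.Fin using (Fin)
open import Data.Product using (_×_; _,_; ∃; proj₁)
open import Function.Definitions using (Injective)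
open import Relation.Binary.PropositionalEquality using (_≡_)

open import Algebra.Bundles using (AbelianGroup; CommutativeRing)
open import Algebra.Solver.Ring.AlmostCommutativeRing using (fromCommutativeRing; _-Raw-AlmostCommutative⟶_)
open import Algebra.Structures using (IsAbelianGroup; IsCommutativeRing)
import Algebra.Properties.CommutativeSemigroup as CommutativeSemigroupProperties
import Algebra.Properties.Group as GroupProperties
import Algebra.Solver.Ring as RingSolver
open import Data.Bool using (Bool; true; false; if_then_else_; _xor_)
open import Data.Bool.Properties
  using (xor-assoc; xor-comm; xor-identityˡ; xor-identityʳ; xor-same; xor-∧-commutativeRing) renaming (_≟_ to _≟B_)
open import Data.Empty using (⊥-elim)
open import Data.Integer as ℤ using (ℤ; 0ℤ; 1ℤ; ∣_∣)
import Data.Integer.Properties as ℤP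
open import Data.Integer.Tactic.RingSolver using (solve-∀)
open import Data.List as List using (List; []; _∷_; _++_; filter)
open import Data.List.Membership.Propositional using (_∈_; _∉_)
open import Data.List.Membership.Propositional.Properties
  using (∈-∃++; ∈-map⁺; ∈-map⁻; ∈-++⁺ˡ; ∈-++⁺ʳ; ∈-filter⁺; ∈-filter⁻)
import Data.List.Membership.DecPropositional as DecMembership
open import Data.List.Properties using (length-++; length-map; length-replicate; filter-none; filter-++)
open import Data.List.Relation.Binary.Disjoint.Propositional using (Disjoint)
open import Data.List.Relation.Binary.Permutation.Propositional using (_↭_; prep; ↭-sym; ↭-trans; ↭⇒↭ₛ)
open import Data.List.Relation.Binary.Permutation.Propositional.Properties
  using (∈-resp-↭; ↭-length) renaming (shift to ↭-shift)
import Data.List.Relation.Binary.Permutation.Setoid.Properties as SetoidPermutation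
open import Data.List.Relation.Binary.Subset.Propositional using (_⊆_)
import Data.List.Relation.Unary.All as All
import Data.List.Relation.Unary.All.Properties as All
open import Data.List.Relation.Unary.Any using (here; there)
open import Data.List.Relation.Unary.Unique.Propositional using (Unique; []; _∷_)
open import Data.List.Relation.Unary.Unique.Propositional.Properties using (++⁺; map⁺; filter⁺; Unique[x∷xs]⇒x∉xs)
import Data.Maybe as Maybe
open import Data.Nat as ℕ using (zero; _∸_; _<_; z≤n; s≤s)
open import Data.Nat.Divisibility using (_∣?_; _∣0; ∣-refl; ∣1⇒≡1; ∣m∣n⇒∣m+n; ∣m∸n∣n⇒∣m)
open import Data.Nat.GCD using (gcd-greatest)
open import Data.Nat.Induction using (<-rec)
open import Data.Nat.Primality using (¬prime[1]; prime⇒nonZero)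
import Data.Nat.Properties as ℕP
open import Data.Product using (proj₂; Σ-syntax)
open import Data.Sum as Sum using (_⊎_; inj₁; inj₂; [_,_]′)
open import Data.Vec as Vec using (Vec; []; _∷_; init; last; head; toList; replicate)
open import Data.Vec.Properties
  using (zipWith-assoc; zipWith-comm; zipWith-identityˡ; zipWith-identityʳ; length-toList; ∷-injectiveˡ; ∷-injectiveʳ)
import Data.Fin as Fin
open import Function using (id; _∘_; case_of_)
open import Level using (0ℓ)
open import Relation.Binary.PropositionalEquality
open import Relation.Binary.PropositionalEquality.Properties using () renaming (setoid to ≡-setoid)
open import Relation.Nullary using (Dec; ¬_; ¬?; yes; no; does)
open import Relation.Nullary.Decidable using (dec⇒maybe)
open import Relation.Unary using (Pred; Decidable)
open ≡-Reasoning

-- Write a_m = #D(𝔽_{2^m}) − 1 − 2^m. The recurrence defining the L-polynomial says that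
-- Σ a_m t^m is the logarithmic derivative t L′/L, so L_{D_k} = Q · L_{D_1} with
-- Q = ∏ q_i(t^{p_i}) gives a^{(k)} = a^{(1)} + t Q′/Q. Logarithmic derivatives add over
-- products, and that of a series in t^p is again a series in t^p; hence a_m^{(k)} = a_m^{(1)}
-- as soon as no p_i divides m, in particular when gcd(k, m) = 1.
-- On the curve, y² + y = c has 1 + (−1)^{Tr c} solutions in 𝔽_{2^m}: y ↦ y² + y is two-to-one
-- into the kernel of the trace, which has at most 2^{m−1} elements because the trace is a
-- polynomial of degree 2^{m−1}. Summing over x ≠ 0 gives #D_k(𝔽_{2^m}) = 2^m + 1 + G_m^{(k)},
-- so equal a_m force equal G_m.

Unique-⊆⊇⇒↭ : {A : Set} {xs ys : List A} → Unique xs → Unique ys → xs ⊆ ys → ys ⊆ xs → xs ↭ ys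
Unique-⊆⊇⇒↭ {xs = []}     {[]}     _ _ _ _ = _↭_.refl
Unique-⊆⊇⇒↭ {xs = []}     {y ∷ ys} _ _ _ ys⊆xs with () ← ys⊆xs (here refl)
Unique-⊆⊇⇒↭ {A} {x ∷ xs} {ys} x∷xs!@(_ ∷ xs!) ys! xs⊆ys ys⊆xs
  with ys₁ , ys₂ , refl ← ∈-∃++ (xs⊆ys (here refl)) = ↭-trans (prep x xs↭rest) (↭-sym ys↭x∷rest)
  where
  rest : List A
  rest = ys₁ ++ ys₂
  ys↭x∷rest : ys₁ ++ x ∷ ys₂ ↭ x ∷ rest
  ys↭x∷rest = ↭-shift x ys₁ ys₂
  x∷rest! : Unique (x ∷ rest)
  x∷rest! = SetoidPermutation.Unique-resp-↭ (≡-setoid A) (↭⇒↭ₛ ys↭x∷rest) ys!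
  x∉xs : x ∉ xs
  x∉xs = Unique[x∷xs]⇒x∉xs x∷xs!
  x∉rest : x ∉ rest
  x∉rest = Unique[x∷xs]⇒x∉xs x∷rest!
  xs⊆rest : xs ⊆ rest
  xs⊆rest z∈xs with ∈-resp-↭ ys↭x∷rest (xs⊆ys (there z∈xs))
  ... | here refl    = ⊥-elim (x∉xs z∈xs)
  ... | there z∈rest = z∈rest
  rest⊆xs : rest ⊆ xs
  rest⊆xs z∈rest with ys⊆xs (∈-resp-↭ (↭-sym ys↭x∷rest) (there z∈rest))
  ... | here refl  = ⊥-elim (x∉rest z∈rest)
  ... | there z∈xs = z∈xs
  xs↭rest : xs ↭ rest
  xs↭rest with _ ∷ rest! ← x∷rest! = Unique-⊆⊇⇒↭ xs! rest! xs⊆rest rest⊆xs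

open CommutativeSemigroupProperties (AbelianGroup.commutativeSemigroup ℤP.+-0-abelianGroup)
  using () renaming (interchange to ℤ-interchange)
open GroupProperties (AbelianGroup.group ℤP.+-0-abelianGroup)
  using () renaming (∙-cancelˡ to ℤ-cancelˡ; ∙-cancelʳ to ℤ-cancelʳ)

-- Formal power series over ℤ

module PowerSeries where

  open import Data.Integer using (_+_; _*_; _-_)

  Seq : Set
  Seq = ℕ → ℤ

  infixl 7 _⊛_
  _⊛_ : Seq → Seq → Seq
  (u ⊛ v) n = Σ< (suc n) (λ i → u i * v (n ∸ i))

  D : Seq → Seq
  D u n = ℤ.+ n * u n

  Σ<-cong : ∀ N {g h : ℕ → ℤ} → (∀ i → i < N → g i ≡ h i) → Σ< N g ≡ Σ< N h
  Σ<-cong zero    _   = refl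
  Σ<-cong (suc N) g≡h = cong₂ _+_ (Σ<-cong N (λ i i<N → g≡h i (ℕP.m<n⇒m<1+n i<N))) (g≡h N ℕP.≤-refl)

  Σ<-zero : ∀ N {g : ℕ → ℤ} → (∀ i → i < N → g i ≡ 0ℤ) → Σ< N g ≡ 0ℤ
  Σ<-zero zero    _    = refl
  Σ<-zero (suc N) g≡0 = cong₂ _+_ (Σ<-zero N (λ i i<N → g≡0 i (ℕP.m<n⇒m<1+n i<N))) (g≡0 N ℕP.≤-refl)

  Σ<-+ : ∀ N (g h : ℕ → ℤ) → Σ< N (λ i → g i + h i) ≡ Σ< N g + Σ< N h
  Σ<-+ zero    g h = refl
  Σ<-+ (suc N) g h = trans (cong (_+ (g N + h N)) (Σ<-+ N g h)) (ℤ-interchange (Σ< N g) (Σ< N h) (g N) (h N))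

  Σ<-*ˡ : ∀ N c (g : ℕ → ℤ) → c * Σ< N g ≡ Σ< N (λ i → c * g i)
  Σ<-*ˡ zero    c g = ℤP.*-zeroʳ c
  Σ<-*ˡ (suc N) c g = trans (ℤP.*-distribˡ-+ c (Σ< N g) (g N)) (cong (_+ c * g N) (Σ<-*ˡ N c g))

  Σ<-*ʳ : ∀ N c (g : ℕ → ℤ) → Σ< N g * c ≡ Σ< N (λ i → g i * c)
  Σ<-*ʳ N c g = trans (ℤP.*-comm (Σ< N g) c) (trans (Σ<-*ˡ N c g) (Σ<-cong N (λ i _ → ℤP.*-comm c (g i))))

  Σ<-first : ∀ N (g : ℕ → ℤ) → Σ< (suc N) g ≡ g 0 + Σ< N (g ∘ suc)
  Σ<-first zero    g = ℤP.+-comm 0ℤ (g 0)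
  Σ<-first (suc N) g = trans (cong (_+ g (suc N)) (Σ<-first N g)) (ℤP.+-assoc (g 0) _ (g (suc N)))

  Σ<-reverse : ∀ n (g : ℕ → ℤ) → Σ< (suc n) g ≡ Σ< (suc n) (λ i → g (n ∸ i))
  Σ<-reverse zero    g = refl
  Σ<-reverse (suc n) g = begin
    Σ< (suc (suc n)) g                                 ≡⟨ Σ<-first (suc n) g ⟩
    g 0 + Σ< (suc n) (g ∘ suc)                         ≡⟨ cong (g 0 +_) (Σ<-reverse n (g ∘ suc)) ⟩
    g 0 + Σ< (suc n) (λ i → g (suc (n ∸ i)))           ≡⟨ ℤP.+-comm (g 0) _ ⟩
    Σ< (suc n) (λ i → g (suc (n ∸ i))) + g 0           ≡⟨ cong₂ _+_ (Σ<-cong (suc n) (λ i i≤n → cong g (sym (ℕP.+-∸-assoc 1 (ℕP.≤-pred i≤n)))))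
                                                                     (cong g (sym (ℕP.n∸n≡0 n))) ⟩
    Σ< (suc n) (λ i → g (suc n ∸ i)) + g (n ∸ n)       ∎

  Σ<-triangle : ∀ n (h : ℕ → ℕ → ℤ) →
                Σ< (suc n) (λ i → Σ< (suc i) (h i)) ≡ Σ< (suc n) (λ j → Σ< (suc (n ∸ j)) (λ l → h (j ℕ.+ l) j))
  Σ<-triangle zero    h = refl
  Σ<-triangle (suc n) h = begin
    Σ< (suc n) (λ i → Σ< (suc i) (h i)) + (Σ< (suc n) (h (suc n)) + h (suc n) (suc n))
      ≡⟨ cong (_+ (Σ< (suc n) (h (suc n)) + h (suc n) (suc n))) (Σ<-triangle n h) ⟩
    Σ< (suc n) column + (Σ< (suc n) (h (suc n)) + h (suc n) (suc n))
      ≡⟨ sym (ℤP.+-assoc (Σ< (suc n) column) _ _) ⟩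
    (Σ< (suc n) column + Σ< (suc n) (h (suc n))) + h (suc n) (suc n)
      ≡⟨ cong₂ _+_ (trans (sym (Σ<-+ (suc n) column (h (suc n)))) (Σ<-cong (suc n) extend)) last-column ⟩
    Σ< (suc n) column′ + Σ< (suc (suc n ∸ suc n)) (λ l → h (suc n ℕ.+ l) (suc n)) ∎
    where
    column column′ : ℕ → ℤ
    column  j = Σ< (suc (n ∸ j)) (λ l → h (j ℕ.+ l) j)
    column′ j = Σ< (suc (suc n ∸ j)) (λ l → h (j ℕ.+ l) j)
    extend : ∀ j → j < suc n → column j + h (suc n) j ≡ column′ j
    extend j j≤n rewrite ℕP.+-∸-assoc 1 (ℕP.≤-pred j≤n) =
      cong (λ i → column j + h i j) (sym (trans (ℕP.+-suc j (n ∸ j)) (cong suc (ℕP.m+[n∸m]≡n (ℕP.≤-pred j≤n)))))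
    last-column : h (suc n) (suc n) ≡ Σ< (suc (suc n ∸ suc n)) (λ l → h (suc n ℕ.+ l) (suc n))
    last-column rewrite ℕP.n∸n≡0 n | ℕP.+-identityʳ n = sym (ℤP.+-identityˡ _)

  ⊛-congˡ : ∀ {u u′} v → (∀ i → u i ≡ u′ i) → ∀ n → (u ⊛ v) n ≡ (u′ ⊛ v) n
  ⊛-congˡ v u≗u′ n = Σ<-cong (suc n) (λ i _ → cong (_* v (n ∸ i)) (u≗u′ i))

  ⊛-congʳ : ∀ u {v v′} → (∀ i → v i ≡ v′ i) → ∀ n → (u ⊛ v) n ≡ (u ⊛ v′) n
  ⊛-congʳ u v≗v′ n = Σ<-cong (suc n) (λ i _ → cong (u i *_) (v≗v′ (n ∸ i)))

  ⊛-comm : ∀ u v n → (u ⊛ v) n ≡ (v ⊛ u) n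
  ⊛-comm u v n = trans (Σ<-reverse n _) (Σ<-cong (suc n) (λ i i≤n →
    trans (cong (λ j → u (n ∸ i) * v j) (ℕP.m∸[m∸n]≡n (ℕP.≤-pred i≤n))) (ℤP.*-comm (u (n ∸ i)) (v i))))

  ⊛-assoc : ∀ u v w n → ((u ⊛ v) ⊛ w) n ≡ (u ⊛ (v ⊛ w)) n
  ⊛-assoc u v w n = begin
    Σ< (suc n) (λ i → (u ⊛ v) i * w (n ∸ i))
      ≡⟨ Σ<-cong (suc n) (λ i _ → Σ<-*ʳ (suc i) (w (n ∸ i)) _) ⟩
    Σ< (suc n) (λ i → Σ< (suc i) (λ j → u j * v (i ∸ j) * w (n ∸ i)))
      ≡⟨ Σ<-triangle n (λ i j → u j * v (i ∸ j) * w (n ∸ i)) ⟩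
    Σ< (suc n) (λ j → Σ< (suc (n ∸ j)) (λ l → u j * v (j ℕ.+ l ∸ j) * w (n ∸ (j ℕ.+ l))))
      ≡⟨ Σ<-cong (suc n) (λ j _ → trans (Σ<-cong (suc (n ∸ j)) (λ l _ → reindex j l)) (sym (Σ<-*ˡ (suc (n ∸ j)) (u j) _))) ⟩
    Σ< (suc n) (λ j → u j * (v ⊛ w) (n ∸ j)) ∎
    where
    reindex : ∀ j l → u j * v (j ℕ.+ l ∸ j) * w (n ∸ (j ℕ.+ l)) ≡ u j * (v l * w (n ∸ j ∸ l))
    reindex j l rewrite ℕP.m+n∸m≡n j l | ℕP.∸-+-assoc n j l = ℤP.*-assoc (u j) (v l) (w (n ∸ (j ℕ.+ l)))

  ⊛-distribʳ-+ : ∀ a b u n → ((λ i → a i + b i) ⊛ u) n ≡ (a ⊛ u) n + (b ⊛ u) n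
  ⊛-distribʳ-+ a b u n = trans (Σ<-cong (suc n) (λ i _ → ℤP.*-distribʳ-+ (u (n ∸ i)) (a i) (b i))) (Σ<-+ (suc n) _ _)

  D-⊛ : ∀ u v n → D (u ⊛ v) n ≡ (D u ⊛ v) n + (u ⊛ D v) n
  D-⊛ u v n = begin
    ℤ.+ n * (u ⊛ v) n                                                       ≡⟨ Σ<-*ˡ (suc n) (ℤ.+ n) _ ⟩
    Σ< (suc n) (λ i → ℤ.+ n * (u i * v (n ∸ i)))                             ≡⟨ Σ<-cong (suc n) (λ i i≤n → split i (ℕP.≤-pred i≤n)) ⟩
    Σ< (suc n) (λ i → D u i * v (n ∸ i) + u i * D v (n ∸ i))                 ≡⟨ Σ<-+ (suc n) _ _ ⟩
    (D u ⊛ v) n + (u ⊛ D v) n                                                 ∎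
    where
    leibniz : ∀ i j x y → (i + j) * (x * y) ≡ i * x * y + x * (j * y)
    leibniz = solve-∀
    split : ∀ i → i ≤ n → ℤ.+ n * (u i * v (n ∸ i)) ≡ D u i * v (n ∸ i) + u i * D v (n ∸ i)
    split i i≤n = trans (cong (λ m → ℤ.+ m * (u i * v (n ∸ i))) (sym (ℕP.m+[n∸m]≡n i≤n)))
                        (trans (cong (_* (u i * v (n ∸ i))) (ℤP.pos-+ i (n ∸ i))) (leibniz (ℤ.+ i) (ℤ.+ (n ∸ i)) (u i) (v (n ∸ i))))

  -- D is t d/dt, so IsLogDerivative a u says that a = t u′/u.
  IsLogDerivative : Seq → Seq → Set
  IsLogDerivative a u = ∀ n → D u n ≡ (a ⊛ u) n

  IsLogDerivative-cong : ∀ {a u v} → (∀ n → u n ≡ v n) → IsLogDerivative a u → IsLogDerivative a v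
  IsLogDerivative-cong {a} u≗v a-u n = trans (cong (ℤ.+ n *_) (sym (u≗v n))) (trans (a-u n) (⊛-congʳ a u≗v n))

  IsLogDerivative-⊛ : ∀ {a b u v} → IsLogDerivative a u → IsLogDerivative b v → IsLogDerivative (λ i → a i + b i) (u ⊛ v)
  IsLogDerivative-⊛ {a} {b} {u} {v} a-u b-v n = begin
    D (u ⊛ v) n                          ≡⟨ D-⊛ u v n ⟩
    (D u ⊛ v) n + (u ⊛ D v) n            ≡⟨ cong₂ _+_ (⊛-congˡ v a-u n) (⊛-congʳ u b-v n) ⟩
    ((a ⊛ u) ⊛ v) n + (u ⊛ (b ⊛ v)) n    ≡⟨ cong₂ _+_ (⊛-assoc a u v n) (sym (⊛-assoc u b v n)) ⟩
    (a ⊛ (u ⊛ v)) n + ((u ⊛ b) ⊛ v) n    ≡⟨ cong ((a ⊛ (u ⊛ v)) n +_) (trans (⊛-congˡ v (⊛-comm u b) n) (⊛-assoc b u v n)) ⟩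
    (a ⊛ (u ⊛ v)) n + (b ⊛ (u ⊛ v)) n    ≡⟨ sym (⊛-distribʳ-+ a b (u ⊛ v) n) ⟩
    ((λ i → a i + b i) ⊛ (u ⊛ v)) n      ∎

  ⊛-last : ∀ a u n → (a ⊛ u) n ≡ Σ< n (λ i → a i * u (n ∸ i)) + a n * u 0
  ⊛-last a u n = cong (λ j → Σ< n (λ i → a i * u (n ∸ i)) + a n * u j) (ℕP.n∸n≡0 n)

  ⊛-cancelʳ : ∀ {a b} u → u 0 ≢ 0ℤ → (∀ n → (a ⊛ u) n ≡ (b ⊛ u) n) → ∀ n → a n ≡ b n
  ⊛-cancelʳ {a} {b} u u₀≢0 a⊛u≗b⊛u = <-rec _ λ n a≗b-below →
    ℤP.*-cancelʳ-≡ (a n) (b n) (u 0) {{ℤ.≢-nonZero u₀≢0}} (ℤ-cancelˡ (Σ< n (λ i → a i * u (n ∸ i))) _ _ (begin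
      Σ< n (λ i → a i * u (n ∸ i)) + a n * u 0   ≡⟨ sym (⊛-last a u n) ⟩
      (a ⊛ u) n                                  ≡⟨ a⊛u≗b⊛u n ⟩
      (b ⊛ u) n                                  ≡⟨ ⊛-last b u n ⟩
      Σ< n (λ i → b i * u (n ∸ i)) + b n * u 0   ≡⟨ cong (_+ b n * u 0) (Σ<-cong n (λ i i<n → cong (_* u (n ∸ i)) (sym (a≗b-below i<n)))) ⟩
      Σ< n (λ i → a i * u (n ∸ i)) + b n * u 0   ∎))

  IsLogDerivative-unique : ∀ {a b} u → u 0 ≢ 0ℤ → IsLogDerivative a u → IsLogDerivative b u → ∀ n → a n ≡ b n
  IsLogDerivative-unique u u₀≢0 a-u b-u = ⊛-cancelʳ u u₀≢0 (λ n → trans (sym (a-u n)) (b-u n))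

  -- In (a ⊛ u) j with p ∤ j every term a_i u_{j−i} with i < j vanishes: either p ∤ i (induction)
  -- or p ∣ i, and then p ∤ j − i.
  IsLogDerivative-support : ∀ {a u} p → u 0 ≢ 0ℤ → (∀ j → ¬ p ∣ j → u j ≡ 0ℤ) → IsLogDerivative a u →
                            ∀ j → ¬ p ∣ j → a j ≡ 0ℤ
  IsLogDerivative-support {a} {u} p u₀≢0 u-support a-u = <-rec _ λ j a-support-below p∤j →
    ℤP.*-cancelʳ-≡ (a j) 0ℤ (u 0) {{ℤ.≢-nonZero u₀≢0}} (begin
      a j * u 0                                  ≡⟨ sym (ℤP.+-identityˡ _) ⟩
      0ℤ + a j * u 0                             ≡⟨ cong (_+ a j * u 0) (sym (Σ<-zero j (λ i i<j → lower-term i i<j p∤j a-support-below))) ⟩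
      Σ< j (λ i → a i * u (j ∸ i)) + a j * u 0   ≡⟨ sym (⊛-last a u j) ⟩
      (a ⊛ u) j                                  ≡⟨ sym (a-u j) ⟩
      ℤ.+ j * u j                                ≡⟨ cong (ℤ.+ j *_) (u-support j p∤j) ⟩
      ℤ.+ j * 0ℤ                                 ≡⟨ ℤP.*-zeroʳ (ℤ.+ j) ⟩
      0ℤ                                         ∎)
    where
    lower-term : ∀ i {j} → i < j → ¬ p ∣ j → (∀ {i} → i < j → ¬ p ∣ i → a i ≡ 0ℤ) → a i * u (j ∸ i) ≡ 0ℤ
    lower-term i {j} i<j p∤j a-support-below with p ∣? i
    ... | yes p∣i = trans (cong (a i *_) (u-support (j ∸ i) (λ p∣j∸i → p∤j (∣m∸n∣n⇒∣m p (ℕP.<⇒≤ i<j) p∣j∸i p∣i)))) (ℤP.*-zeroʳ (a i))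
    ... | no  p∤i = cong (_* u (j ∸ i)) (a-support-below i<j p∤i)

  -- a_N = u₀ (N u_N − Σ_{i<N} a_i u_{N−i}), using u₀⁻¹ = u₀, is built by course-of-values
  -- recursion: approx N is a table that agrees with a below N.
  module _ (u : Seq) (u₀²≡1 : u 0 * u 0 ≡ 1ℤ) where

    private
      next : ℕ → Seq → ℤ
      next N a = u 0 * (D u N - Σ< N (λ i → a i * u (N ∸ i)))

      approx : ℕ → Seq
      approx zero    _ = 0ℤ
      approx (suc N) i with i ℕ.≟ N
      ... | yes _ = next N (approx N)
      ... | no  _ = approx N i

      logD : Seq
      logD i = approx (suc i) i

      logD-next : ∀ N → logD N ≡ next N (approx N)
      logD-next N with N ℕ.≟ N
      ... | yes _  = refl
      ... | no N≢N = ⊥-elim (N≢N refl)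

      approx-stable : ∀ N {i} → i < N → approx N i ≡ logD i
      approx-stable (suc N) {i} i<1+N with i ℕ.≟ N
      ... | yes refl = sym (logD-next i)
      ... | no  i≢N  = approx-stable N (ℕP.≤∧≢⇒< (ℕP.≤-pred i<1+N) i≢N)

      cancel : ∀ s x c → s + c * (x - s) * c ≡ s + (x - s) * (c * c)
      cancel = solve-∀

      unit : ∀ s x → s + (x - s) * 1ℤ ≡ x
      unit = solve-∀

      logD-isLogDerivative : IsLogDerivative logD u
      logD-isLogDerivative n = sym (begin
        Σ< n (λ i → logD i * u (n ∸ i)) + logD n * u (n ∸ n)  ≡⟨ cong₂ (λ l j → S + l * u j) (logD-next n) (ℕP.n∸n≡0 n) ⟩
        S + next n (approx n) * u 0                           ≡⟨ cong (λ s → S + u 0 * (D u n - s) * u 0) (Σ<-cong n (λ i i<n → cong (_* u (n ∸ i)) (approx-stable n i<n))) ⟩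
        S + u 0 * (D u n - S) * u 0                           ≡⟨ cancel S (D u n) (u 0) ⟩
        S + (D u n - S) * (u 0 * u 0)                         ≡⟨ cong (λ c → S + (D u n - S) * c) u₀²≡1 ⟩
        S + (D u n - S) * 1ℤ                                  ≡⟨ unit S (D u n) ⟩
        D u n                                                 ∎)
        where
        S : ℤ
        S = Σ< n (λ i → logD i * u (n ∸ i))

    logDerivative-exists : ∃ λ a → IsLogDerivative a u
    logDerivative-exists = logD , logD-isLogDerivative

  coeff-addP : ∀ p q i → coeff (addP p q) i ≡ coeff p i + coeff q i
  coeff-addP []       q        i       = sym (ℤP.+-identityˡ _)
  coeff-addP (a ∷ as) []       i       = sym (ℤP.+-identityʳ _)
  coeff-addP (a ∷ as) (b ∷ bs) zero    = refl
  coeff-addP (a ∷ as) (b ∷ bs) (suc i) = coeff-addP as bs i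

  coeff-map-* : ∀ c q i → coeff (List.map (c *_) q) i ≡ c * coeff q i
  coeff-map-* c []       i       = sym (ℤP.*-zeroʳ c)
  coeff-map-* c (x ∷ xs) zero    = refl
  coeff-map-* c (x ∷ xs) (suc i) = coeff-map-* c xs i

  coeff-mulP : ∀ p q n → coeff (mulP p q) n ≡ (coeff p ⊛ coeff q) n
  coeff-mulP []       q n       = sym (Σ<-zero (suc n) (λ _ _ → refl))
  coeff-mulP (c ∷ cs) q zero    = begin
    coeff (addP (List.map (c *_) q) (0ℤ ∷ mulP cs q)) 0   ≡⟨ coeff-addP (List.map (c *_) q) (0ℤ ∷ mulP cs q) 0 ⟩
    coeff (List.map (c *_) q) 0 + 0ℤ                     ≡⟨ ℤP.+-identityʳ _ ⟩
    coeff (List.map (c *_) q) 0                          ≡⟨ coeff-map-* c q 0 ⟩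
    c * coeff q 0                                        ≡⟨ sym (ℤP.+-identityˡ _) ⟩
    (coeff (c ∷ cs) ⊛ coeff q) 0                         ∎
  coeff-mulP (c ∷ cs) q (suc n) = begin
    coeff (addP (List.map (c *_) q) (0ℤ ∷ mulP cs q)) (suc n)   ≡⟨ coeff-addP (List.map (c *_) q) (0ℤ ∷ mulP cs q) (suc n) ⟩
    coeff (List.map (c *_) q) (suc n) + coeff (mulP cs q) n      ≡⟨ cong₂ _+_ (coeff-map-* c q (suc n)) (coeff-mulP cs q n) ⟩
    c * coeff q (suc n) + (coeff cs ⊛ coeff q) n                ≡⟨ sym (Σ<-first (suc n) _) ⟩
    (coeff (c ∷ cs) ⊛ coeff q) (suc n)                          ∎

  coeff-replicate : ∀ k i → coeff (List.replicate k 0ℤ) i ≡ 0ℤ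
  coeff-replicate zero    i       = refl
  coeff-replicate (suc k) zero    = refl
  coeff-replicate (suc k) (suc i) = coeff-replicate k i

  coeff-++ˡ : ∀ xs ys {i} → i < List.length xs → coeff (xs List.++ ys) i ≡ coeff xs i
  coeff-++ˡ (x ∷ xs) ys {zero}  _         = refl
  coeff-++ˡ (x ∷ xs) ys {suc i} (s≤s i<l) = coeff-++ˡ xs ys i<l

  coeff-++ʳ : ∀ xs ys i → coeff (xs List.++ ys) (List.length xs ℕ.+ i) ≡ coeff ys i
  coeff-++ʳ []       ys i = refl
  coeff-++ʳ (x ∷ xs) ys i = coeff-++ʳ xs ys i

  coeff-expand : ∀ p .{{_ : ℕ.NonZero p}} q j → ¬ p ∣ j → coeff (expand p q) j ≡ 0ℤ
  coeff-expand p        []       j       _   = refl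
  coeff-expand p        (c ∷ cs) zero    p∤0 = ⊥-elim (p∤0 (p ∣0))
  coeff-expand (suc p′) (c ∷ cs) (suc j) p∤j with j ℕ.<? p′
  ... | yes j<p′ = trans (coeff-++ˡ (List.replicate p′ 0ℤ) _ (subst (j <_) (sym (length-replicate p′)) j<p′)) (coeff-replicate p′ j)
  ... | no  j≮p′ = begin
    coeff (zeros List.++ expand (suc p′) cs) j                         ≡⟨ cong (coeff (zeros List.++ _)) (sym j≡) ⟩
    coeff (zeros List.++ expand (suc p′) cs) (List.length zeros ℕ.+ k) ≡⟨ coeff-++ʳ zeros _ k ⟩
    coeff (expand (suc p′) cs) k                                       ≡⟨ coeff-expand (suc p′) cs k (λ p∣k → p∤j (subst (suc p′ ∣_) (cong suc p′+k≡j) (∣m∣n⇒∣m+n ∣-refl p∣k))) ⟩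
    0ℤ                                                                 ∎
    where
    zeros : List ℤ
    zeros = List.replicate p′ 0ℤ
    k : ℕ
    k = j ∸ p′
    p′+k≡j : p′ ℕ.+ k ≡ j
    p′+k≡j = ℕP.m+[n∸m]≡n (ℕP.≮⇒≥ j≮p′)
    j≡ : List.length zeros ℕ.+ k ≡ j
    j≡ = trans (cong (ℕ._+ k) (length-replicate p′)) p′+k≡j

  ∣i∣≡1⇒i*i≡1 : ∀ i → ∣ i ∣ ≡ 1 → i * i ≡ 1ℤ
  ∣i∣≡1⇒i*i≡1 (ℤ.+ 1)    _ = refl
  ∣i∣≡1⇒i*i≡1 ℤ.-[1+ 0 ] _ = refl

  ∣i∣≡1⇒i≢0 : ∀ i → ∣ i ∣ ≡ 1 → i ≢ 0ℤ
  ∣i∣≡1⇒i≢0 _ ∣i∣≡1 refl with () ← ∣i∣≡1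

  ∣i*j∣≡1⇒∣i∣≡1×∣j∣≡1 : ∀ i j → ∣ i * j ∣ ≡ 1 → ∣ i ∣ ≡ 1 × ∣ j ∣ ≡ 1
  ∣i*j∣≡1⇒∣i∣≡1×∣j∣≡1 i j ∣ij∣≡1 = ℕP.m*n≡1⇒m≡1 (∣ i ∣) (∣ j ∣) ∣i∣∣j∣≡1 , ℕP.m*n≡1⇒n≡1 (∣ i ∣) (∣ j ∣) ∣i∣∣j∣≡1
    where
    ∣i∣∣j∣≡1 : ∣ i ∣ ℕ.* ∣ j ∣ ≡ 1
    ∣i∣∣j∣≡1 = trans (sym (ℤP.abs-* i j)) ∣ij∣≡1

  logDerivative-expand : ∀ p .{{_ : ℕ.NonZero p}} q → ∣ coeff (expand p q) 0 ∣ ≡ 1 →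
                         ∃ λ a → IsLogDerivative a (coeff (expand p q)) × (∀ m → ¬ p ∣ m → a m ≡ 0ℤ)
  logDerivative-expand p q ∣E₀∣≡1 =
    let a , a-E = logDerivative-exists (coeff (expand p q)) (∣i∣≡1⇒i*i≡1 (coeff (expand p q) 0) ∣E₀∣≡1)
    in  a , a-E , IsLogDerivative-support p (∣i∣≡1⇒i≢0 (coeff (expand p q) 0) ∣E₀∣≡1) (coeff-expand p q) a-E

  logDerivative-prodFin-expand : ∀ {r} (ps : Fin r → ℕ) (qs : Fin r → Poly) → (∀ i → ℕ.NonZero (ps i)) →
    let Q = coeff (prodFin (λ i → expand (ps i) (qs i))) in
    ∣ Q 0 ∣ ≡ 1 → ∃ λ b → IsLogDerivative b Q × (∀ m → (∀ i → ¬ ps i ∣ m) → b m ≡ 0ℤ)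
  logDerivative-prodFin-expand {zero} ps qs _ _ = (λ _ → 0ℤ) , constant , λ _ _ → refl
    where
    constant : IsLogDerivative (λ _ → 0ℤ) (coeff (1ℤ ∷ []))
    constant zero    = refl
    constant (suc n) = trans (ℤP.*-zeroʳ (ℤ.+ suc n)) (sym (Σ<-zero (suc (suc n)) (λ _ _ → refl)))
  logDerivative-prodFin-expand {suc r} ps qs ps≢0 ∣Q₀∣≡1 =
    let ∣E₀∣≡1 , ∣R₀∣≡1     = ∣i*j∣≡1⇒∣i∣≡1×∣j∣≡1 (coeff E 0) (coeff R 0)
                                (trans (cong ∣_∣ (sym (trans (coeff-mulP E R 0) (ℤP.+-identityˡ (coeff E 0 * coeff R 0))))) ∣Q₀∣≡1)
        a , a-E , a-support = logDerivative-expand (ps Fin.zero) {{ps≢0 Fin.zero}} (qs Fin.zero) ∣E₀∣≡1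
        b , b-R , b-support = logDerivative-prodFin-expand (ps ∘ Fin.suc) (qs ∘ Fin.suc) (ps≢0 ∘ Fin.suc) ∣R₀∣≡1
    in  (λ i → a i + b i)
      , IsLogDerivative-cong {λ i → a i + b i} (λ n → sym (coeff-mulP E R n)) (IsLogDerivative-⊛ {a} {b} a-E b-R)
      , λ m p∤m → cong₂ _+_ (a-support m (p∤m Fin.zero)) (b-support m (p∤m ∘ Fin.suc))
    where
    E R : Poly
    E = expand (ps Fin.zero) (qs Fin.zero)
    R = prodFin (λ i → expand (ps (Fin.suc i)) (qs (Fin.suc i)))

  -- traceSeq ff k m = #D_k(𝔽_{2^m}) − 1 − 2^m for m ≥ 1, with constant term 0.
  traceSeq : FieldFamily → ℕ → Seq
  traceSeq ff k zero    = 0ℤ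
  traceSeq ff k (suc j) = traceTerm ff k j

  IsLPolynomial⇒IsLogDerivative : ∀ ff k L → IsLPolynomial ff k L → IsLogDerivative (traceSeq ff k) (coeff L)
  IsLPolynomial⇒IsLogDerivative ff k L _                zero    = refl
  IsLPolynomial⇒IsLogDerivative ff k L (_ , recurrence) (suc n) =
    trans (recurrence n) (trans (sym (ℤP.+-identityˡ _)) (sym (Σ<-first (suc n) (λ i → traceSeq ff k i * coeff L (suc n ∸ i)))))

  traceTerm-agree : ∀ ff k {r} (ps : Fin r → ℕ) qs Lk L1 → (∀ i → ℕ.NonZero (ps i)) →
                    IsLPolynomial ff k Lk → IsLPolynomial ff 1 L1 →
                    Lk ≈P mulP (prodFin (λ i → expand (ps i) (qs i))) L1 →
                    ∀ n → (∀ i → ¬ ps i ∣ suc n) → traceTerm ff k n ≡ traceTerm ff 1 n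
  traceTerm-agree ff k ps qs Lk L1 ps≢0 isLk isL1 Lk≈QL1 n ps∤m =
    let b , b-Q , b-support = logDerivative-prodFin-expand ps qs ps≢0 (cong ∣_∣ Q₀≡1)
        b+A₁ : Seq
        b+A₁ i = b i + traceSeq ff 1 i
        b+A₁-Lk = IsLogDerivative-cong {b+A₁} (λ i → sym (Lk≗Q⊛L1 i))
                    (IsLogDerivative-⊛ {b} {traceSeq ff 1} b-Q (IsLPolynomial⇒IsLogDerivative ff 1 L1 isL1))
    in begin
      traceTerm ff k n              ≡⟨ IsLogDerivative-unique {traceSeq ff k} {b+A₁} (coeff Lk) Lk₀≢0
                                         (IsLPolynomial⇒IsLogDerivative ff k Lk isLk) b+A₁-Lk (suc n) ⟩
      b (suc n) + traceTerm ff 1 n  ≡⟨ cong (_+ traceTerm ff 1 n) (b-support (suc n) ps∤m) ⟩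
      0ℤ + traceTerm ff 1 n         ≡⟨ ℤP.+-identityˡ _ ⟩
      traceTerm ff 1 n              ∎
    where
    Q : Poly
    Q = prodFin (λ i → expand (ps i) (qs i))
    Lk≗Q⊛L1 : ∀ i → coeff Lk i ≡ (coeff Q ⊛ coeff L1) i
    Lk≗Q⊛L1 i = trans (Lk≈QL1 i) (coeff-mulP Q L1 i)
    Lk₀≢0 : coeff Lk 0 ≢ 0ℤ
    Lk₀≢0 Lk₀≡0 with () ← trans (sym (proj₁ isLk)) Lk₀≡0
    Q₀≡1 : coeff Q 0 ≡ 1ℤ
    Q₀≡1 = begin
      coeff Q 0                 ≡⟨ sym (ℤP.*-identityʳ _) ⟩
      coeff Q 0 * 1ℤ            ≡⟨ cong (coeff Q 0 *_) (sym (proj₁ isL1)) ⟩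
      coeff Q 0 * coeff L1 0    ≡⟨ sym (trans (Lk≗Q⊛L1 0) (ℤP.+-identityˡ _)) ⟩
      coeff Lk 0                ≡⟨ proj₁ isLk ⟩
      1ℤ                        ∎

-- Arithmetic in 𝔽₂[x]/(f)

xor-self : ∀ {m} (v : Vec Bool m) → Vec.zipWith _xor_ v v ≡ replicate m false
xor-self []      = refl
xor-self (x ∷ v) = cong₂ _∷_ (xor-same x) (xor-self v)

init-zipWith : ∀ {A : Set} {k} (_∙_ : A → A → A) (u v : Vec A (suc k)) → init (Vec.zipWith _∙_ u v) ≡ Vec.zipWith _∙_ (init u) (init v)
init-zipWith {k = zero}  _∙_ (x ∷ []) (y ∷ []) = refl
init-zipWith {k = suc k} _∙_ (x ∷ u)  (y ∷ v)  = cong ((x ∙ y) ∷_) (init-zipWith _∙_ u v)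

last-zipWith : ∀ {A : Set} {k} (_∙_ : A → A → A) (u v : Vec A (suc k)) → last (Vec.zipWith _∙_ u v) ≡ last u ∙ last v
last-zipWith {k = zero}  _∙_ (x ∷ []) (y ∷ []) = refl
last-zipWith {k = suc k} _∙_ (x ∷ u)  (y ∷ v)  = last-zipWith _∙_ u v

init-replicate : ∀ {A : Set} k (x : A) → init (replicate (suc k) x) ≡ replicate k x
init-replicate zero    x = refl
init-replicate (suc k) x = cong (x ∷_) (init-replicate k x)

last-replicate : ∀ {A : Set} k (x : A) → last (replicate (suc k) x) ≡ x
last-replicate zero    x = refl
last-replicate (suc k) x = last-replicate k x

module _ {n : ℕ} where

  infixl 6 _+_
  infixr 7 _·_

  _+_ : F n → F n → F n
  _+_ = addF

  addF-isAbelianGroup : IsAbelianGroup _≡_ _+_ zeroF id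
  addF-isAbelianGroup = record
    { isGroup = record
      { isMonoid = record
        { isSemigroup = record
          { isMagma = record { isEquivalence = isEquivalence ; ∙-cong = cong₂ _+_ }
          ; assoc = zipWith-assoc xor-assoc }
        ; identity = zipWith-identityˡ xor-identityˡ , zipWith-identityʳ xor-identityʳ }
      ; inverse = xor-self , xor-self
      ; ⁻¹-cong = id }
    ; comm = zipWith-comm xor-comm }

  open IsAbelianGroup addF-isAbelianGroup public
    using () renaming (assoc to addF-assoc; identityˡ to addF-identityˡ; identityʳ to addF-identityʳ)

  addF-abelianGroup : AbelianGroup 0ℓ 0ℓ
  addF-abelianGroup = record { isAbelianGroup = addF-isAbelianGroup }

  open CommutativeSemigroupProperties (AbelianGroup.commutativeSemigroup addF-abelianGroup) public
    using (x∙yz≈zy∙x) renaming (interchange to addF-interchange)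

  addF-self : ∀ (a : F n) → a + a ≡ zeroF
  addF-self = xor-self

  _·_ : Bool → F n → F n
  b · a = if b then a else zeroF

  ·-distrib-xor : ∀ b c a → (b xor c) · a ≡ b · a + c · a
  ·-distrib-xor false c    a = sym (addF-identityˡ _)
  ·-distrib-xor true false a = sym (addF-identityʳ a)
  ·-distrib-xor true true  a = sym (addF-self a)

  ·-distrib-+ : ∀ b u v → b · (u + v) ≡ b · u + b · v
  ·-distrib-+ true  u v = refl
  ·-distrib-+ false u v = sym (addF-self zeroF)

  ·-zeroʳ : ∀ b → b · zeroF ≡ zeroF
  ·-zeroʳ true  = refl
  ·-zeroʳ false = refl

  additive⇒zero : (h : F n → F n) → (∀ u v → h (u + v) ≡ h u + h v) → h zeroF ≡ zeroF
  additive⇒zero h h-+ = begin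
    h zeroF             ≡⟨ cong h (sym (addF-self zeroF)) ⟩
    h (zeroF + zeroF)   ≡⟨ h-+ zeroF zeroF ⟩
    h zeroF + h zeroF   ≡⟨ addF-self (h zeroF) ⟩
    zeroF               ∎

  shift : F n → F n
  shift v = false ∷ init v

  mulX-shift : ∀ g v → mulX g v ≡ shift v + last v · g
  mulX-shift g v with last v
  ... | true  = refl
  ... | false = sym (addF-identityʳ _)

  mulX-noCarry : ∀ g v → last v ≡ false → mulX g v ≡ shift v
  mulX-noCarry g v last≡false rewrite last≡false = refl

  mulX-+ : ∀ g u v → mulX g (u + v) ≡ mulX g u + mulX g v
  mulX-+ g u v = begin
    mulX g (u + v)                               ≡⟨ mulX-shift g (u + v) ⟩
    shift (u + v) + last (u + v) · g             ≡⟨ cong₂ _+_ (cong (false ∷_) (init-zipWith _xor_ u v))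
                                                      (trans (cong (_· g) (last-zipWith _xor_ u v)) (·-distrib-xor (last u) (last v) g)) ⟩
    (shift u + shift v) + (last u · g + last v · g) ≡⟨ addF-interchange _ _ _ _ ⟩
    (shift u + last u · g) + (shift v + last v · g) ≡⟨ sym (cong₂ _+_ (mulX-shift g u) (mulX-shift g v)) ⟩
    mulX g u + mulX g v                          ∎

  module _ (g : F n) where

    mulAux-+ˡ : ∀ u v bs → mulAux g (u + v) bs ≡ mulAux g u bs + mulAux g v bs
    mulAux-+ˡ u v []       = sym (addF-self zeroF)
    mulAux-+ˡ u v (b ∷ bs) = begin
      b · (u + v) + mulAux g (mulX g (u + v)) bs
        ≡⟨ cong₂ _+_ (·-distrib-+ b u v) (trans (cong (λ w → mulAux g w bs) (mulX-+ g u v)) (mulAux-+ˡ (mulX g u) (mulX g v) bs)) ⟩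
      (b · u + b · v) + (mulAux g (mulX g u) bs + mulAux g (mulX g v) bs)
        ≡⟨ addF-interchange _ _ _ _ ⟩
      (b · u + mulAux g (mulX g u) bs) + (b · v + mulAux g (mulX g v) bs) ∎

    mulAux-+ʳ : ∀ {k} a (u v : Vec Bool k) →
                mulAux g a (toList (Vec.zipWith _xor_ u v)) ≡ mulAux g a (toList u) + mulAux g a (toList v)
    mulAux-+ʳ a []      []      = sym (addF-self zeroF)
    mulAux-+ʳ a (x ∷ u) (y ∷ v) = begin
      (x xor y) · a + mulAux g (mulX g a) (toList (Vec.zipWith _xor_ u v))
        ≡⟨ cong₂ _+_ (·-distrib-xor x y a) (mulAux-+ʳ (mulX g a) u v) ⟩
      (x · a + y · a) + (mulAux g (mulX g a) (toList u) + mulAux g (mulX g a) (toList v))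
        ≡⟨ addF-interchange _ _ _ _ ⟩
      (x · a + mulAux g (mulX g a) (toList u)) + (y · a + mulAux g (mulX g a) (toList v)) ∎

    mulAux-zeroˡ : ∀ bs → mulAux g zeroF bs ≡ zeroF
    mulAux-zeroˡ bs = additive⇒zero (λ a → mulAux g a bs) (λ u v → mulAux-+ˡ u v bs)

    mulAux-falses : ∀ k a → mulAux g a (toList (replicate k false)) ≡ zeroF
    mulAux-falses zero    a = refl
    mulAux-falses (suc k) a = trans (addF-identityˡ _) (mulAux-falses k (mulX g a))

    mulX-zero : mulX g zeroF ≡ zeroF
    mulX-zero = additive⇒zero (mulX g) (mulX-+ g)

    mulX-· : ∀ b a → mulX g (b · a) ≡ b · mulX g a
    mulX-· true  a = refl
    mulX-· false a = mulX-zero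

    mulAux-· : ∀ b a bs → mulAux g (b · a) bs ≡ b · mulAux g a bs
    mulAux-· true  a bs = refl
    mulAux-· false a bs = mulAux-zeroˡ bs

    mulAux-mulX : ∀ a bs → mulAux g (mulX g a) bs ≡ mulX g (mulAux g a bs)
    mulAux-mulX a []       = sym mulX-zero
    mulAux-mulX a (b ∷ bs) = begin
      b · mulX g a + mulAux g (mulX g (mulX g a)) bs   ≡⟨ cong₂ _+_ (sym (mulX-· b a)) (mulAux-mulX (mulX g a) bs) ⟩
      mulX g (b · a) + mulX g (mulAux g (mulX g a) bs) ≡⟨ sym (mulX-+ g _ _) ⟩
      mulX g (b · a + mulAux g (mulX g a) bs)          ∎

    mulAux-swap : ∀ a cs bs → mulAux g (mulAux g a cs) bs ≡ mulAux g (mulAux g a bs) cs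
    mulAux-swap a []       bs = mulAux-zeroˡ bs
    mulAux-swap a (c ∷ cs) bs = begin
      mulAux g (c · a + mulAux g (mulX g a) cs) bs              ≡⟨ mulAux-+ˡ _ _ bs ⟩
      mulAux g (c · a) bs + mulAux g (mulAux g (mulX g a) cs) bs ≡⟨ cong₂ _+_ (mulAux-· c a bs) (mulAux-swap (mulX g a) cs bs) ⟩
      c · mulAux g a bs + mulAux g (mulAux g (mulX g a) bs) cs   ≡⟨ cong (λ w → c · mulAux g a bs + mulAux g w cs) (mulAux-mulX a bs) ⟩
      c · mulAux g a bs + mulAux g (mulX g (mulAux g a bs)) cs   ∎

-- With the zero modulus, multiplication by x is a plain shift. Up to x^(m−1) nothing is carried
-- out of the top coefficient, so powers of x, and hence 1 * a, do not depend on the modulus.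
xPow : ∀ {n} → F n → ℕ → F n
xPow g zero    = oneF
xPow g (suc i) = mulX g (xPow g i)

mulX-zeroModulus : ∀ {n} (v : F n) → mulX zeroF v ≡ shift v
mulX-zeroModulus v = trans (mulX-shift zeroF v) (trans (cong (shift v +_) (·-zeroʳ (last v))) (addF-identityʳ _))

mulX-zeroModulus-∷ : ∀ {p} (v : F p) → mulX (zeroF {suc p}) (false ∷ v) ≡ false ∷ mulX zeroF v
mulX-zeroModulus-∷ v = trans (mulX-zeroModulus (false ∷ v)) (cong (false ∷_) (sym (mulX-zeroModulus v)))

xPow-zeroModulus-suc : ∀ {p} i → xPow (zeroF {suc p}) (suc i) ≡ false ∷ xPow zeroF i
xPow-zeroModulus-suc {p} zero = trans (mulX-zeroModulus oneF) (cong (λ w → false ∷ true ∷ w) (init-replicate p false))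
xPow-zeroModulus-suc (suc i) = trans (cong (mulX zeroF) (xPow-zeroModulus-suc i)) (mulX-zeroModulus-∷ _)

last-xPow-zeroModulus : ∀ {p} i → i < p → last (xPow (zeroF {p}) i) ≡ false
last-xPow-zeroModulus {suc p} zero    _         = last-replicate p false
last-xPow-zeroModulus {suc p} (suc i) (s≤s i<p) =
  trans (cong last (xPow-zeroModulus-suc i)) (last-xPow-zeroModulus i i<p)

xPow-modulus-irrelevant : ∀ {n} (g : F n) i → i ≤ n → xPow g i ≡ xPow zeroF i
xPow-modulus-irrelevant g zero    _      = refl
xPow-modulus-irrelevant g (suc i) i<n = begin
  mulX g (xPow g i)           ≡⟨ cong (mulX g) (xPow-modulus-irrelevant g i (ℕP.≤-pred (ℕP.m≤n⇒m≤1+n i<n))) ⟩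
  mulX g (xPow zeroF i)       ≡⟨ mulX-noCarry g _ (last-xPow-zeroModulus i i<n) ⟩
  shift (xPow zeroF i)        ≡⟨ sym (mulX-noCarry zeroF _ (last-xPow-zeroModulus i i<n)) ⟩
  mulX zeroF (xPow zeroF i)   ∎

mulAux-modulus-irrelevant : ∀ {n} (g : F n) i bs → i ℕ.+ List.length bs ≤ suc n →
                            mulAux g (xPow g i) bs ≡ mulAux zeroF (xPow zeroF i) bs
mulAux-modulus-irrelevant g i []       _ = refl
mulAux-modulus-irrelevant g i (b ∷ bs) i+1+l≤m = cong₂ (λ u w → b · u + w)
  (xPow-modulus-irrelevant g i (ℕP.≤-pred (ℕP.≤-trans (s≤s (ℕP.m≤m+n i _)) i+1+l≤m′)))
  (mulAux-modulus-irrelevant g (suc i) bs i+1+l≤m′)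
  where
  i+1+l≤m′ : suc i ℕ.+ List.length bs ≤ suc _
  i+1+l≤m′ = ℕP.≤-trans (ℕP.≤-reflexive (sym (ℕP.+-suc i _))) i+1+l≤m

mulAux-zeroModulus-∷ : ∀ {p} (v : F p) bs → mulAux (zeroF {suc p}) (false ∷ v) bs ≡ false ∷ mulAux zeroF v bs
mulAux-zeroModulus-∷ v []       = refl
mulAux-zeroModulus-∷ v (b ∷ bs) = cong₂ _+_ (·-∷ b)
  (trans (cong (λ w → mulAux zeroF w bs) (mulX-zeroModulus-∷ v)) (mulAux-zeroModulus-∷ (mulX zeroF v) bs))
  where
  ·-∷ : ∀ b → b · (false ∷ v) ≡ false ∷ b · v
  ·-∷ true  = refl
  ·-∷ false = refl

mulAux-zeroModulus-oneF : ∀ {p} (a : F p) → mulAux zeroF oneF (toList a) ≡ a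
mulAux-zeroModulus-oneF {zero}  (true  ∷ []) = refl
mulAux-zeroModulus-oneF {zero}  (false ∷ []) = refl
mulAux-zeroModulus-oneF {suc p} (a₀ ∷ a) = begin
  a₀ · oneF + mulAux zeroF (xPow zeroF 1) (toList a)   ≡⟨ cong (λ w → a₀ · oneF + mulAux zeroF w (toList a)) (xPow-zeroModulus-suc 0) ⟩
  a₀ · oneF + mulAux zeroF (false ∷ oneF) (toList a)   ≡⟨ cong (a₀ · oneF +_) (mulAux-zeroModulus-∷ oneF (toList a)) ⟩
  a₀ · oneF + (false ∷ mulAux zeroF oneF (toList a))   ≡⟨ cong (λ w → a₀ · oneF + (false ∷ w)) (mulAux-zeroModulus-oneF a) ⟩
  a₀ · oneF + (false ∷ a)                              ≡⟨ ·-oneF-+ a₀ ⟩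
  a₀ ∷ a                                               ∎
  where
  ·-oneF-+ : ∀ b → b · oneF + (false ∷ a) ≡ b ∷ a
  ·-oneF-+ true  = cong (true ∷_) (addF-identityˡ a)
  ·-oneF-+ false = cong (false ∷_) (addF-identityˡ a)

module Ring {n : ℕ} (f : F n) where

  infixl 7 _*_
  _*_ : F n → F n → F n
  _*_ = mulF f

  *-identityˡ : ∀ a → oneF * a ≡ a
  *-identityˡ a = trans (mulAux-modulus-irrelevant f 0 (toList a) (ℕP.≤-reflexive (length-toList a))) (mulAux-zeroModulus-oneF a)

  *-identityʳ : ∀ a → a * oneF ≡ a
  *-identityʳ a = trans (cong (a +_) (mulAux-falses f n (mulX f a))) (addF-identityʳ a)

  *-zeroʳ : ∀ a → a * zeroF ≡ zeroF
  *-zeroʳ a = mulAux-falses f (suc n) a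

  *-zeroˡ : ∀ a → zeroF * a ≡ zeroF
  *-zeroˡ a = mulAux-zeroˡ f (toList a)

  *-comm : ∀ a b → a * b ≡ b * a
  *-comm a b = begin
    mulAux f a (toList b)                          ≡⟨ cong (λ w → mulAux f w (toList b)) (sym (*-identityˡ a)) ⟩
    mulAux f (mulAux f oneF (toList a)) (toList b) ≡⟨ mulAux-swap f oneF (toList a) (toList b) ⟩
    mulAux f (mulAux f oneF (toList b)) (toList a) ≡⟨ cong (λ w → mulAux f w (toList a)) (*-identityˡ b) ⟩
    mulAux f b (toList a)                          ∎

  *-assoc : ∀ a b c → (a * b) * c ≡ a * (b * c)
  *-assoc a b c = begin
    (a * b) * c ≡⟨ mulAux-swap f a (toList b) (toList c) ⟩
    (a * c) * b ≡⟨ cong (_* b) (*-comm a c) ⟩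
    (c * a) * b ≡⟨ mulAux-swap f c (toList a) (toList b) ⟩
    (c * b) * a ≡⟨ *-comm (c * b) a ⟩
    a * (c * b) ≡⟨ cong (a *_) (*-comm c b) ⟩
    a * (b * c) ∎

  *-distribˡ-+ : ∀ a b c → a * (b + c) ≡ a * b + a * c
  *-distribˡ-+ a b c = mulAux-+ʳ f a b c

  *-distribʳ-+ : ∀ a b c → (b + c) * a ≡ b * a + c * a
  *-distribʳ-+ a b c = trans (*-comm (b + c) a) (trans (*-distribˡ-+ a b c) (cong₂ _+_ (*-comm a b) (*-comm a c)))

  isCommutativeRing : IsCommutativeRing _≡_ _+_ _*_ id zeroF oneF
  isCommutativeRing = record
    { isRing = record
      { +-isAbelianGroup = addF-isAbelianGroup
      ; *-cong = cong₂ _*_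
      ; *-assoc = *-assoc
      ; *-identity = *-identityˡ , *-identityʳ
      ; distrib = *-distribˡ-+ , *-distribʳ-+ }
    ; *-comm = *-comm }

  commutativeRing : CommutativeRing _ _
  commutativeRing = record { isCommutativeRing = isCommutativeRing }

  -- Coefficients in 𝔽₂ let the solver prove identities that hold only in characteristic 2.
  bitMorphism : CommutativeRing.rawRing xor-∧-commutativeRing -Raw-AlmostCommutative⟶ fromCommutativeRing commutativeRing
  bitMorphism = record
    { ⟦_⟧    = _· oneF
    ; +-homo = λ b c → ·-distrib-xor b c oneF
    ; *-homo = λ { true c → sym (*-identityˡ (c · oneF)) ; false c → sym (*-zeroˡ (c · oneF)) }
    ; -‿homo = λ _ → refl
    ; 0-homo = refl
    ; 1-homo = refl }

  open RingSolver _ _ bitMorphism (λ b c → Maybe.map (cong (_· oneF)) (dec⇒maybe (b ≟B c))) public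
    using (solve; _:+_; _:*_; _:=_; con)


allVecs-unique : ∀ m → Unique (allVecs m)
allVecs-unique zero    = All.[] ∷ []
allVecs-unique (suc m) = ++⁺ (map⁺ ∷-injectiveʳ (allVecs-unique m)) (map⁺ ∷-injectiveʳ (allVecs-unique m)) disjoint
  where
  disjoint : Disjoint (List.map (false ∷_) (allVecs m)) (List.map (true ∷_) (allVecs m))
  disjoint (v∈falses , v∈trues) with ∈-map⁻ (false ∷_) v∈falses | ∈-map⁻ (true ∷_) v∈trues
  ... | _ , _ , refl | _ , _ , ()

allVecs-complete : ∀ {m} (v : Vec Bool m) → v ∈ allVecs m
allVecs-complete []          = here refl
allVecs-complete (false ∷ v) = ∈-++⁺ˡ (∈-map⁺ (false ∷_) (allVecs-complete v))
allVecs-complete (true ∷ v)  = ∈-++⁺ʳ _ (∈-map⁺ (true ∷_) (allVecs-complete v))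

length-allVecs : ∀ m → List.length (allVecs m) ≡ 2 ℕ.^ m
length-allVecs zero    = refl
length-allVecs (suc m) = begin
  List.length (List.map (false ∷_) (allVecs m) List.++ List.map (true ∷_) (allVecs m))
    ≡⟨ length-++ (List.map (false ∷_) (allVecs m)) ⟩
  List.length (List.map (false ∷_) (allVecs m)) ℕ.+ List.length (List.map (true ∷_) (allVecs m))
    ≡⟨ cong₂ ℕ._+_ (length-map _ (allVecs m)) (length-map _ (allVecs m)) ⟩
  List.length (allVecs m) ℕ.+ List.length (allVecs m)
    ≡⟨ cong (λ l → l ℕ.+ l) (length-allVecs m) ⟩
  2 ℕ.^ m ℕ.+ 2 ℕ.^ m
    ≡⟨ cong (2 ℕ.^ m ℕ.+_) (sym (ℕP.+-identityʳ (2 ℕ.^ m))) ⟩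
  2 ℕ.^ suc m ∎

module _ {n : ℕ} where

  allF-unique : Unique (allF n)
  allF-unique = allVecs-unique (suc n)

  ∈-nonzeroF : ∀ {a : F n} → a ≢ zeroF → a ∈ nonzeroF n
  ∈-nonzeroF a≢0 = ∈-filter⁺ (λ a → ¬? (a ≟F zeroF)) (allVecs-complete _) a≢0

  nonzeroF-nonzero : ∀ {a : F n} → a ∈ nonzeroF n → a ≢ zeroF
  nonzeroF-nonzero a∈ = proj₂ (∈-filter⁻ (λ a → ¬? (a ≟F zeroF)) {xs = allF n} a∈)

  nonzeroF-unique : Unique (nonzeroF n)
  nonzeroF-unique = filter⁺ (λ a → ¬? (a ≟F zeroF)) allF-unique

  length-nonzeroF : suc (List.length (nonzeroF n)) ≡ 2 ℕ.^ suc n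
  length-nonzeroF = trans (↭-length zero∷nonzero↭all) (length-allVecs (suc n))
    where
    zero∷nonzero↭all : zeroF ∷ nonzeroF n ↭ allF n
    zero∷nonzero↭all = Unique-⊆⊇⇒↭ (All.tabulate (λ a∈ → ≢-sym (nonzeroF-nonzero a∈)) ∷ nonzeroF-unique) allF-unique
      (λ _ → allVecs-complete _)
      (λ {a} _ → case a ≟F zeroF of λ where
        (yes refl) → here refl
        (no a≢0)   → there (∈-nonzeroF a≢0))

module FiniteField {n : ℕ} (f : F n) (isField : IsFieldModulus f) where

  open Ring f public
  open CommutativeSemigroupProperties (CommutativeRing.*-commutativeSemigroup commutativeRing)
    using () renaming (interchange to *-interchange)
  open GroupProperties (CommutativeRing.+-group commutativeRing) using (x∙y⁻¹≈ε⇒x≈y; ∙-cancelʳ)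
  open SetoidPermutation (≡-setoid (F n)) using (foldr-commMonoid)
  open DecMembership (_≟F_ {n}) using (_∈?_)

  x+y≡0⇒x≡y : ∀ {a b} → a + b ≡ zeroF → a ≡ b
  x+y≡0⇒x≡y = x∙y⁻¹≈ε⇒x≈y _ _

  no-zero-divisors : ∀ a b → a * b ≡ zeroF → a ≡ zeroF ⊎ b ≡ zeroF
  no-zero-divisors a b ab≡0 with a ≟F zeroF
  ... | yes a≡0 = inj₁ a≡0
  ... | no  a≢0 with a⁻¹ , aa⁻¹≡1 ← isField a a≢0 = inj₂ (begin
    b               ≡⟨ sym (*-identityˡ b) ⟩
    oneF * b        ≡⟨ cong (_* b) (sym aa⁻¹≡1) ⟩
    (a * a⁻¹) * b   ≡⟨ mulAux-swap f a (toList a⁻¹) (toList b) ⟩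
    (a * b) * a⁻¹   ≡⟨ cong (_* a⁻¹) ab≡0 ⟩
    zeroF * a⁻¹     ≡⟨ *-zeroˡ a⁻¹ ⟩
    zeroF           ∎)

  *-cancelˡ : ∀ {a} x y → a ≢ zeroF → a * x ≡ a * y → x ≡ y
  *-cancelˡ {a} x y a≢0 ax≡ay with no-zero-divisors a (x + y) a[x+y]≡0
    where
    a[x+y]≡0 : a * (x + y) ≡ zeroF
    a[x+y]≡0 = trans (*-distribˡ-+ a x y) (trans (cong (a * x +_) (sym ax≡ay)) (addF-self (a * x)))
  ... | inj₁ a≡0   = ⊥-elim (a≢0 a≡0)
  ... | inj₂ x+y≡0 = x+y≡0⇒x≡y x+y≡0

  oneF≢zeroF : oneF {n} ≢ zeroF
  oneF≢zeroF ()

  *-nonzero : ∀ {a b} → a ≢ zeroF → b ≢ zeroF → a * b ≢ zeroF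
  *-nonzero {a} {b} a≢0 b≢0 ab≡0 = [ a≢0 , b≢0 ]′ (no-zero-divisors a b ab≡0)

  infixr 8 _^_
  _^_ : F n → ℕ → F n
  _^_ = powF f

  ^-homo-* : ∀ a i j → a ^ (i ℕ.+ j) ≡ a ^ i * a ^ j
  ^-homo-* a zero    j = sym (*-identityˡ (a ^ j))
  ^-homo-* a (suc i) j = trans (cong (a *_) (^-homo-* a i j)) (sym (*-assoc a (a ^ i) (a ^ j)))

  ^-distrib-* : ∀ a b e → (a * b) ^ e ≡ a ^ e * b ^ e
  ^-distrib-* a b zero    = sym (*-identityˡ oneF)
  ^-distrib-* a b (suc e) = trans (cong ((a * b) *_) (^-distrib-* a b e)) (*-interchange a b (a ^ e) (b ^ e))

  ∏ : List (F n) → F n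
  ∏ = List.foldr _*_ oneF

  ∏-map-* : ∀ a xs → ∏ (List.map (a *_) xs) ≡ a ^ List.length xs * ∏ xs
  ∏-map-* a []       = sym (*-identityˡ oneF)
  ∏-map-* a (x ∷ xs) = trans (cong ((a * x) *_) (∏-map-* a xs))
    (solve 4 (λ a x aˡ p → (a :* x) :* (aˡ :* p) := (a :* aˡ) :* (x :* p)) refl a x (a ^ List.length xs) (∏ xs))

  ∏-nonzero : ∀ xs → (∀ {x} → x ∈ xs → x ≢ zeroF) → ∏ xs ≢ zeroF
  ∏-nonzero []       _        ()
  ∏-nonzero (x ∷ xs) xs≢0 ∏≡0 with no-zero-divisors x (∏ xs) ∏≡0
  ... | inj₁ x≡0  = xs≢0 (here refl) x≡0
  ... | inj₂ ∏≡0′ = ∏-nonzero xs (xs≢0 ∘ there) ∏≡0′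

  *-permutes-nonzeroF : ∀ {a} → a ≢ zeroF → List.map (a *_) (nonzeroF n) ↭ nonzeroF n
  *-permutes-nonzeroF {a} a≢0 = Unique-⊆⊇⇒↭ (map⁺ (*-cancelˡ _ _ a≢0) nonzeroF-unique) nonzeroF-unique aF*⊆F* F*⊆aF*
    where
    a⁻¹ : F n
    a⁻¹ = proj₁ (isField a a≢0)
    aa⁻¹≡1 : a * a⁻¹ ≡ oneF
    aa⁻¹≡1 = proj₂ (isField a a≢0)
    a⁻¹≢0 : a⁻¹ ≢ zeroF
    a⁻¹≢0 a⁻¹≡0 = oneF≢zeroF (trans (sym aa⁻¹≡1) (trans (cong (a *_) a⁻¹≡0) (*-zeroʳ a)))
    aF*⊆F* : List.map (a *_) (nonzeroF n) ⊆ nonzeroF n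
    aF*⊆F* ax∈ with x , x∈ , refl ← ∈-map⁻ (a *_) ax∈ = ∈-nonzeroF (*-nonzero a≢0 (nonzeroF-nonzero x∈))
    F*⊆aF* : nonzeroF n ⊆ List.map (a *_) (nonzeroF n)
    F*⊆aF* {x} x∈ = subst (_∈ List.map (a *_) (nonzeroF n)) a[a⁻¹x]≡x
      (∈-map⁺ (a *_) (∈-nonzeroF (*-nonzero a⁻¹≢0 (nonzeroF-nonzero x∈))))
      where
      a[a⁻¹x]≡x : a * (a⁻¹ * x) ≡ x
      a[a⁻¹x]≡x = trans (sym (*-assoc a a⁻¹ x)) (trans (cong (_* x) aa⁻¹≡1) (*-identityˡ x))

  -- ∏ F* = ∏ (a F*) = a ^ |F*| ∏ F*, and ∏ F* ≠ 0.
  ^-|F*|≡1 : ∀ {a} → a ≢ zeroF → a ^ List.length (nonzeroF n) ≡ oneF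
  ^-|F*|≡1 {a} a≢0 = x+y≡0⇒x≡y (case no-zero-divisors (a ^ N + oneF) P [aᴺ+1]P≡0 of λ where
      (inj₁ aᴺ+1≡0) → aᴺ+1≡0
      (inj₂ P≡0)    → ⊥-elim (∏-nonzero (nonzeroF n) nonzeroF-nonzero P≡0))
    where
    N : ℕ
    N = List.length (nonzeroF n)
    P : F n
    P = ∏ (nonzeroF n)
    P≡aᴺP : P ≡ a ^ N * P
    P≡aᴺP = trans (sym (foldr-commMonoid (CommutativeRing.*-isCommutativeMonoid commutativeRing) (↭⇒↭ₛ (*-permutes-nonzeroF a≢0))))
                  (∏-map-* a (nonzeroF n))
    [aᴺ+1]P≡0 : (a ^ N + oneF) * P ≡ zeroF
    [aᴺ+1]P≡0 = begin
      (a ^ N + oneF) * P      ≡⟨ *-distribʳ-+ P (a ^ N) oneF ⟩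
      a ^ N * P + oneF * P    ≡⟨ cong₂ _+_ (sym P≡aᴺP) (*-identityˡ P) ⟩
      P + P                   ≡⟨ addF-self P ⟩
      zeroF                   ∎

  fermat : ∀ a → a ^ (2 ℕ.^ suc n) ≡ a
  fermat a = subst (λ e → a ^ e ≡ a) (length-nonzeroF {n}) (case a ≟F zeroF of λ where
    (yes refl) → *-zeroˡ (zeroF ^ List.length (nonzeroF n))
    (no a≢0)   → trans (cong (a *_) (^-|F*|≡1 a≢0)) (*-identityʳ a))

  ^-2^-suc : ∀ a i → a ^ (2 ℕ.^ suc i) ≡ a ^ (2 ℕ.^ i) * a ^ (2 ℕ.^ i)
  ^-2^-suc a i = trans (cong (λ e → a ^ (2 ℕ.^ i ℕ.+ e)) (ℕP.+-identityʳ (2 ℕ.^ i))) (^-homo-* a (2 ℕ.^ i) (2 ℕ.^ i))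

  ^-2^-suc′ : ∀ a i → a ^ (2 ℕ.^ suc i) ≡ (a * a) ^ (2 ℕ.^ i)
  ^-2^-suc′ a i = trans (^-2^-suc a i) (sym (^-distrib-* a a (2 ℕ.^ i)))

  square-+ : ∀ a b → (a + b) * (a + b) ≡ a * a + b * b
  square-+ = solve 2 (λ a b → (a :+ b) :* (a :+ b) := a :* a :+ b :* b) refl

  frobenius-+ : ∀ i a b → (a + b) ^ (2 ℕ.^ i) ≡ a ^ (2 ℕ.^ i) + b ^ (2 ℕ.^ i)
  frobenius-+ zero    a b = trans (*-identityʳ (a + b)) (sym (cong₂ _+_ (*-identityʳ a) (*-identityʳ b)))
  frobenius-+ (suc i) a b = begin
    (a + b) ^ (2 ℕ.^ suc i)                                   ≡⟨ ^-2^-suc (a + b) i ⟩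
    (a + b) ^ (2 ℕ.^ i) * (a + b) ^ (2 ℕ.^ i)                 ≡⟨ cong (λ c → c * c) (frobenius-+ i a b) ⟩
    (a ^ (2 ℕ.^ i) + b ^ (2 ℕ.^ i)) * (a ^ (2 ℕ.^ i) + b ^ (2 ℕ.^ i)) ≡⟨ square-+ (a ^ (2 ℕ.^ i)) (b ^ (2 ℕ.^ i)) ⟩
    a ^ (2 ℕ.^ i) * a ^ (2 ℕ.^ i) + b ^ (2 ℕ.^ i) * b ^ (2 ℕ.^ i) ≡⟨ sym (cong₂ _+_ (^-2^-suc a i) (^-2^-suc b i)) ⟩
    a ^ (2 ℕ.^ suc i) + b ^ (2 ℕ.^ suc i)                     ∎

  traceSum-+ : ∀ i a b → traceSum f (a + b) i ≡ traceSum f a i + traceSum f b i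
  traceSum-+ zero    a b = sym (addF-self zeroF)
  traceSum-+ (suc i) a b = trans (cong₂ _+_ (frobenius-+ i a b) (traceSum-+ i a b)) (addF-interchange _ _ _ _)

  traceSum-square : ∀ i a → traceSum f a i * traceSum f a i ≡ traceSum f (a * a) i
  traceSum-square zero    a = *-zeroˡ zeroF
  traceSum-square (suc i) a = begin
    (a ^ (2 ℕ.^ i) + traceSum f a i) * (a ^ (2 ℕ.^ i) + traceSum f a i)     ≡⟨ square-+ (a ^ (2 ℕ.^ i)) (traceSum f a i) ⟩
    a ^ (2 ℕ.^ i) * a ^ (2 ℕ.^ i) + traceSum f a i * traceSum f a i        ≡⟨ cong₂ _+_ (trans (sym (^-2^-suc a i)) (^-2^-suc′ a i)) (traceSum-square i a) ⟩
    (a * a) ^ (2 ℕ.^ i) + traceSum f (a * a) i                             ∎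

  traceSum-telescope : ∀ i a → traceSum f (a * a) i + a ≡ traceSum f a i + a ^ (2 ℕ.^ i)
  traceSum-telescope zero    a = cong (zeroF +_) (sym (*-identityʳ a))
  traceSum-telescope (suc i) a = begin
    ((a * a) ^ (2 ℕ.^ i) + traceSum f (a * a) i) + a   ≡⟨ addF-assoc _ _ _ ⟩
    (a * a) ^ (2 ℕ.^ i) + (traceSum f (a * a) i + a)   ≡⟨ cong₂ _+_ (sym (^-2^-suc′ a i)) (traceSum-telescope i a) ⟩
    a ^ (2 ℕ.^ suc i) + (traceSum f a i + a ^ (2 ℕ.^ i)) ≡⟨ x∙yz≈zy∙x _ _ _ ⟩
    (a ^ (2 ℕ.^ i) + traceSum f a i) + a ^ (2 ℕ.^ suc i) ∎

  Tr : F n → F n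
  Tr a = traceSum f a (suc n)

  Tr-square : ∀ a → Tr (a * a) ≡ Tr a
  Tr-square a = ∙-cancelʳ a _ _ (trans (traceSum-telescope (suc n) a) (cong (Tr a +_) (fermat a)))

  Tr-artinSchreier : ∀ a → Tr (a * a + a) ≡ zeroF
  Tr-artinSchreier a = begin
    Tr (a * a + a)      ≡⟨ traceSum-+ (suc n) (a * a) a ⟩
    Tr (a * a) + Tr a   ≡⟨ cong (_+ Tr a) (Tr-square a) ⟩
    Tr a + Tr a         ≡⟨ addF-self (Tr a) ⟩
    zeroF               ∎

  idempotent⇒0∨1 : ∀ t → t * t ≡ t → t ≡ zeroF ⊎ t ≡ oneF
  idempotent⇒0∨1 t t²≡t with no-zero-divisors t (t + oneF) t[t+1]≡0
    where
    t[t+1]≡0 : t * (t + oneF) ≡ zeroF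
    t[t+1]≡0 = begin
      t * (t + oneF)     ≡⟨ *-distribˡ-+ t t oneF ⟩
      t * t + t * oneF   ≡⟨ cong₂ _+_ t²≡t (*-identityʳ t) ⟩
      t + t              ≡⟨ addF-self t ⟩
      zeroF              ∎
  ... | inj₁ t≡0   = inj₁ t≡0
  ... | inj₂ t+1≡0 = inj₂ (x+y≡0⇒x≡y t+1≡0)

  Tr-idempotent : ∀ a → Tr a * Tr a ≡ Tr a
  Tr-idempotent a = begin
    Tr a * Tr a   ≡⟨ traceSum-square (suc n) a ⟩
    Tr (a * a)    ≡⟨ Tr-square a ⟩
    Tr a          ∎

  trF≡false⇒Tr≡0 : ∀ a → trF f a ≡ false → Tr a ≡ zeroF
  trF≡false⇒Tr≡0 a trF≡false = [ id , Tr≡1⇒Tr≡0 ]′ (idempotent⇒0∨1 (Tr a) (Tr-idempotent a))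
    where
    Tr≡1⇒Tr≡0 : Tr a ≡ oneF → Tr a ≡ zeroF
    Tr≡1⇒Tr≡0 Tr≡1 with () ← trans (sym (cong head Tr≡1)) trF≡false

  eval : ∀ {d} → Vec (F n) d → F n → F n
  eval []       y = zeroF
  eval (c ∷ cs) y = c + y * eval cs y

  -- Synthetic division by y − r = y + r.
  monic-division : ∀ d (cs : Vec (F n) (suc d)) r → Σ[ qs ∈ Vec (F n) d ] ∀ y →
                   y ^ suc d + eval cs y ≡ (y + r) * (y ^ d + eval qs y) + (r ^ suc d + eval cs r)
  monic-division zero (c ∷ []) r = [] , λ y → solve 3
    (λ y r c → y :* con true :+ (c :+ y :* con false)
            := (y :+ r) :* (con true :+ con false) :+ (r :* con true :+ (c :+ r :* con false))) refl y r c
  monic-division (suc d) (c ∷ cs) r with qs , cs≡ ← monic-division d cs r = (q ∷ qs) , λ y → begin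
    y * (y * y ^ d) + (c + y * eval cs y)
      ≡⟨ solve 4 (λ y yᵈ c e → y :* (y :* yᵈ) :+ (c :+ y :* e) := c :+ y :* (y :* yᵈ :+ e)) refl y (y ^ d) c (eval cs y) ⟩
    c + y * (y ^ suc d + eval cs y)
      ≡⟨ cong (λ e → c + y * e) (cs≡ y) ⟩
    c + y * ((y + r) * (y ^ d + eval qs y) + q)
      ≡⟨ solve 6 (λ y r c yᵈ e q → c :+ y :* ((y :+ r) :* (yᵈ :+ e) :+ q)
                               := (y :+ r) :* (y :* yᵈ :+ (q :+ y :* e)) :+ (r :* q :+ c)) refl y r c (y ^ d) (eval qs y) q ⟩
    (y + r) * (y ^ suc d + (q + y * eval qs y)) + (r * q + c)
      ≡⟨ cong ((y + r) * (y ^ suc d + (q + y * eval qs y)) +_)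
           (solve 4 (λ r rᵈ⁺¹ c e → r :* (rᵈ⁺¹ :+ e) :+ c := r :* rᵈ⁺¹ :+ (c :+ r :* e)) refl r (r ^ suc d) c (eval cs r)) ⟩
    (y + r) * (y ^ suc d + (q + y * eval qs y)) + (r ^ suc (suc d) + (c + r * eval cs r)) ∎
    where
    q : F n
    q = r ^ suc d + eval cs r

  monic-roots : ∀ d (cs : Vec (F n) d) rs → Unique rs → (∀ {r} → r ∈ rs → r ^ d + eval cs r ≡ zeroF) → List.length rs ≤ d
  monic-roots zero    []  []      _ _     = z≤n
  monic-roots zero    []  (r ∷ _) _ roots = ⊥-elim (oneF≢zeroF (trans (sym (addF-identityʳ oneF)) (roots (here refl))))
  monic-roots (suc d) cs  []      _ _     = z≤n
  monic-roots (suc d) cs  (r ∷ rs) (r∉rs ∷ rs!) roots with qs , cs≡ ← monic-division d cs r =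
    s≤s (monic-roots d qs rs rs! qs-roots)
    where
    qs-roots : ∀ {s} → s ∈ rs → s ^ d + eval qs s ≡ zeroF
    qs-roots {s} s∈rs with no-zero-divisors (s + r) (s ^ d + eval qs s) (begin
        (s + r) * (s ^ d + eval qs s)                                   ≡⟨ sym (addF-identityʳ _) ⟩
        (s + r) * (s ^ d + eval qs s) + zeroF                           ≡⟨ cong (_ +_) (sym (roots (here refl))) ⟩
        (s + r) * (s ^ d + eval qs s) + (r ^ suc d + eval cs r)         ≡⟨ sym (cs≡ s) ⟩
        s ^ suc d + eval cs s                                           ≡⟨ roots (there s∈rs) ⟩
        zeroF                                                           ∎)
    ... | inj₁ s+r≡0 = ⊥-elim (All.lookup r∉rs s∈rs (sym (x+y≡0⇒x≡y s+r≡0)))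
    ... | inj₂ qs[s]≡0 = qs[s]≡0

  -- h is a polynomial function with d coefficients, i.e. of degree < d.
  IsPolynomial : ℕ → (F n → F n) → Set
  IsPolynomial d h = Σ[ cs ∈ Vec (F n) d ] ∀ y → h y ≡ eval cs y

  eval-zeros : ∀ d y → eval (replicate d zeroF) y ≡ zeroF
  eval-zeros zero    y = refl
  eval-zeros (suc d) y = trans (addF-identityˡ _) (trans (cong (y *_) (eval-zeros d y)) (*-zeroʳ y))

  eval-+ : ∀ {d} (cs ds : Vec (F n) d) y → eval (Vec.zipWith _+_ cs ds) y ≡ eval cs y + eval ds y
  eval-+ []       []       y = sym (addF-self zeroF)
  eval-+ (c ∷ cs) (d ∷ ds) y = trans (cong (λ e → (c + d) + y * e) (eval-+ cs ds y))
    (solve 5 (λ c d y e e′ → (c :+ d) :+ y :* (e :+ e′) := (c :+ y :* e) :+ (d :+ y :* e′)) refl c d y (eval cs y) (eval ds y))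

  zero-isPolynomial : ∀ d → IsPolynomial d (λ _ → zeroF)
  zero-isPolynomial d = replicate d zeroF , λ y → sym (eval-zeros d y)

  ^-isPolynomial : ∀ {e d} → e < d → IsPolynomial d (_^ e)
  ^-isPolynomial {zero}  {suc d} _ = (oneF ∷ replicate d zeroF) , λ y →
    sym (trans (cong (λ e → oneF + y * e) (eval-zeros d y)) (trans (cong (oneF +_) (*-zeroʳ y)) (addF-identityʳ oneF)))
  ^-isPolynomial {suc e} {suc d} (s≤s e<d) with cs , cs≡ ← ^-isPolynomial e<d =
    (zeroF ∷ cs) , λ y → trans (cong (y *_) (cs≡ y)) (sym (addF-identityˡ _))

  +-isPolynomial : ∀ {d g h} → IsPolynomial d g → IsPolynomial d h → IsPolynomial d (λ y → g y + h y)
  +-isPolynomial (cs , cs≡) (ds , ds≡) = Vec.zipWith _+_ cs ds , λ y → trans (cong₂ _+_ (cs≡ y) (ds≡ y)) (sym (eval-+ cs ds y))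

  traceSum-isPolynomial : ∀ i → i ≤ n → IsPolynomial (2 ℕ.^ n) (λ y → traceSum f y i)
  traceSum-isPolynomial zero    _   = zero-isPolynomial _
  traceSum-isPolynomial (suc i) i<n = +-isPolynomial (^-isPolynomial (ℕP.^-monoʳ-< 2 (s≤s (s≤s z≤n)) i<n)) (traceSum-isPolynomial i (ℕP.<⇒≤ i<n))

  -- Tr y = y ^ 2ⁿ + (terms of lower degree)
  Tr-roots : ∀ rs → Unique rs → (∀ {r} → r ∈ rs → Tr r ≡ zeroF) → List.length rs ≤ 2 ℕ.^ n
  Tr-roots rs rs! roots with cs , cs≡ ← traceSum-isPolynomial n ℕP.≤-refl =
    monic-roots (2 ℕ.^ n) cs rs rs! (λ {r} r∈rs → trans (cong (r ^ 2 ℕ.^ n +_) (sym (cs≡ r))) (roots r∈rs))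

  artinSchreier : F n → F n
  artinSchreier y = y * y + y

  artinSchreier-+1 : ∀ y → artinSchreier (y + oneF) ≡ artinSchreier y
  artinSchreier-+1 = solve 1 (λ y → (y :+ con true) :* (y :+ con true) :+ (y :+ con true) := y :* y :+ y) refl

  artinSchreier-factor : ∀ y z → (y + z) * (y + z + oneF) ≡ artinSchreier y + artinSchreier z
  artinSchreier-factor = solve 2 (λ y z → (y :+ z) :* (y :+ z :+ con true) := (y :* y :+ y) :+ (z :* z :+ z)) refl

  artinSchreier-fibre : ∀ y z → artinSchreier y ≡ artinSchreier z → y ≡ z ⊎ y ≡ z + oneF
  artinSchreier-fibre y z ℘y≡℘z =
    Sum.map x+y≡0⇒x≡y y+z+1≡0⇒y≡z+1 (no-zero-divisors (y + z) (y + z + oneF) [y+z][y+z+1]≡0)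
    where
    [y+z][y+z+1]≡0 : (y + z) * (y + z + oneF) ≡ zeroF
    [y+z][y+z+1]≡0 = begin
      (y + z) * (y + z + oneF)            ≡⟨ artinSchreier-factor y z ⟩
      artinSchreier y + artinSchreier z   ≡⟨ cong (_+ artinSchreier z) ℘y≡℘z ⟩
      artinSchreier z + artinSchreier z   ≡⟨ addF-self (artinSchreier z) ⟩
      zeroF                               ∎
    y+z+1≡0⇒y≡z+1 : y + z + oneF ≡ zeroF → y ≡ z + oneF
    y+z+1≡0⇒y≡z+1 y+z+1≡0 = x+y≡0⇒x≡y (trans (sym (addF-assoc y z oneF)) y+z+1≡0)

  -- y ↦ y² + y is injective on the 2ⁿ elements with constant coefficient 0 and its values are
  -- roots of Tr, which has at most 2ⁿ roots; so every root of Tr is such a value.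
  artinSchreier-surjective : ∀ c → Tr c ≡ zeroF → ∃ λ y → artinSchreier y ≡ c
  artinSchreier-surjective c Trc≡0 = case c ∈? image of λ where
      (yes c∈image) → case ∈-map⁻ (artinSchreier ∘ (false ∷_)) c∈image of λ where
        (v , _ , c≡℘v) → false ∷ v , sym c≡℘v
      (no c∉image) → ⊥-elim (ℕP.<-irrefl refl (subst (_≤ 2 ℕ.^ n) (cong suc length-image)
        (Tr-roots (c ∷ image) (All.tabulate (λ c′∈ c≡c′ → c∉image (subst (_∈ image) (sym c≡c′) c′∈)) ∷ image-unique)
          (All.lookup (Trc≡0 All.∷ image-roots)))))
    where
    image : List (F n)
    image = List.map (artinSchreier ∘ (false ∷_)) (allVecs n)
    length-image : List.length image ≡ 2 ℕ.^ n
    length-image = trans (length-map _ (allVecs n)) (length-allVecs n)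
    injective : ∀ {v w} → artinSchreier (false ∷ v) ≡ artinSchreier (false ∷ w) → v ≡ w
    injective {v} {w} ℘≡ = [ ∷-injectiveʳ , (λ v≡w+1 → case ∷-injectiveˡ v≡w+1 of λ ()) ]′ (artinSchreier-fibre (false ∷ v) (false ∷ w) ℘≡)
    image-unique : Unique image
    image-unique = map⁺ injective (allVecs-unique n)
    image-roots : All.All (λ c′ → Tr c′ ≡ zeroF) image
    image-roots = All.map⁺ (All.universal (λ v → Tr-artinSchreier (false ∷ v)) (allVecs n))

  solutions : F n → List (F n)
  solutions c = filter (λ y → artinSchreier y ≟F c) (allF n)

  length-solutions-trF≡true : ∀ c → trF f c ≡ true → List.length (solutions c) ≡ 0
  length-solutions-trF≡true c trc = cong List.length (filter-none (λ y → artinSchreier y ≟F c) (All.universal no-solution (allF n)))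
    where
    no-solution : ∀ y → artinSchreier y ≢ c
    no-solution y ℘y≡c = case trans (sym trc) (trans (cong (trF f) (sym ℘y≡c)) (cong head (Tr-artinSchreier y))) of λ ()

  x≢x+1 : ∀ x → x ≢ x + oneF
  x≢x+1 x x≡x+1 = oneF≢zeroF (begin
    oneF               ≡⟨ sym (addF-identityˡ oneF) ⟩
    zeroF + oneF       ≡⟨ cong (_+ oneF) (sym (addF-self x)) ⟩
    (x + x) + oneF     ≡⟨ addF-assoc x x oneF ⟩
    x + (x + oneF)     ≡⟨ cong (x +_) (sym x≡x+1) ⟩
    x + x              ≡⟨ addF-self x ⟩
    zeroF              ∎)

  length-solutions-solvable : ∀ {c} y₀ → artinSchreier y₀ ≡ c → List.length (solutions c) ≡ 2
  length-solutions-solvable {c} y₀ ℘y₀≡c = ↭-length (Unique-⊆⊇⇒↭ (filter⁺ _ allF-unique) two-unique sols⊆ ⊆sols)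
    where
    two-unique : Unique (y₀ ∷ y₀ + oneF ∷ [])
    two-unique = (x≢x+1 y₀ All.∷ All.[]) ∷ All.[] ∷ []
    sols⊆ : solutions c ⊆ y₀ ∷ y₀ + oneF ∷ []
    sols⊆ {y} y∈ = [ here , there ∘ here ]′
      (artinSchreier-fibre y y₀ (trans (proj₂ (∈-filter⁻ (λ y → artinSchreier y ≟F c) {xs = allF n} y∈)) (sym ℘y₀≡c)))
    ⊆sols : y₀ ∷ y₀ + oneF ∷ [] ⊆ solutions c
    ⊆sols (here refl)         = ∈-filter⁺ (λ y → artinSchreier y ≟F c) (allVecs-complete _) ℘y₀≡c
    ⊆sols (there (here refl)) = ∈-filter⁺ (λ y → artinSchreier y ≟F c) (allVecs-complete _) (trans (artinSchreier-+1 y₀) ℘y₀≡c)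

  length-solutions : ∀ c → ℤ.+ List.length (solutions c) ≡ 1ℤ ℤ.+ sign (trF f c)
  length-solutions c = by-trace (trF f c) refl
    where
    by-trace : ∀ b → trF f c ≡ b → ℤ.+ List.length (solutions c) ≡ 1ℤ ℤ.+ sign b
    by-trace true  trc = cong ℤ.+_ (length-solutions-trF≡true c trc)
    by-trace false trc = cong ℤ.+_ (length-solutions-solvable (proj₁ preimage) (proj₂ preimage))
      where
      preimage : ∃ λ y → artinSchreier y ≡ c
      preimage = artinSchreier-surjective c (trF≡false⇒Tr≡0 c trc)


-- Point counts

length-filter-map : ∀ {A B : Set} {P : Pred B 0ℓ} (P? : Decidable P) (g : A → B) xs →
                    List.length (filter P? (List.map g xs)) ≡ List.length (filter (P? ∘ g) xs)
length-filter-map P? g []       = refl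
length-filter-map P? g (x ∷ xs) with does (P? (g x))
... | true  = cong suc (length-filter-map P? g xs)
... | false = length-filter-map P? g xs

module _ {n : ℕ} (f : F n) (isField : IsFieldModulus f) where
  open FiniteField f isField using (solutions; length-solutions)

  affinePoints-G : ∀ k → ℤ.+ affinePoints f k ≡ ℤ.+ List.length (nonzeroF n) ℤ.+ G f k
  affinePoints-G k = count (nonzeroF n)
    where
    isPoint? : (p : F n × F n) → Dec (addF (mulF f (proj₂ p) (proj₂ p)) (proj₂ p) ≡ rhs f k (proj₁ p))
    isPoint? p = addF (mulF f (proj₂ p) (proj₂ p)) (proj₂ p) ≟F rhs f k (proj₁ p)
    points : List (F n) → List (F n × F n)
    points xs = filter isPoint? (List.cartesianProduct xs (allF n))
    signs : List (F n) → ℤ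
    signs xs = List.foldr ℤ._+_ 0ℤ (List.map (λ a → sign (trF f (rhs f k a))) xs)
    count : ∀ xs → ℤ.+ List.length (points xs) ≡ ℤ.+ List.length xs ℤ.+ signs xs
    count []       = refl
    count (x ∷ xs) = begin
      ℤ.+ List.length (filter isPoint? (List.map (x ,_) (allF n) ++ List.cartesianProduct xs (allF n)))
        ≡⟨ cong (λ ps → ℤ.+ List.length ps) (filter-++ isPoint? (List.map (x ,_) (allF n)) _) ⟩
      ℤ.+ List.length (filter isPoint? (List.map (x ,_) (allF n)) ++ points xs)
        ≡⟨ cong ℤ.+_ (length-++ (filter isPoint? (List.map (x ,_) (allF n)))) ⟩
      ℤ.+ (List.length (filter isPoint? (List.map (x ,_) (allF n))) ℕ.+ List.length (points xs))
        ≡⟨ ℤP.pos-+ (List.length (filter isPoint? (List.map (x ,_) (allF n)))) _ ⟩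
      ℤ.+ List.length (filter isPoint? (List.map (x ,_) (allF n))) ℤ.+ ℤ.+ List.length (points xs)
        ≡⟨ cong₂ ℤ._+_ (trans (cong ℤ.+_ (length-filter-map isPoint? (x ,_) (allF n))) (length-solutions (rhs f k x))) (count xs) ⟩
      (1ℤ ℤ.+ sign (trF f (rhs f k x))) ℤ.+ (ℤ.+ List.length xs ℤ.+ signs xs)
        ≡⟨ ℤ-interchange 1ℤ (sign (trF f (rhs f k x))) (ℤ.+ List.length xs) (signs xs) ⟩
      ℤ.+ List.length (x ∷ xs) ℤ.+ signs (x ∷ xs) ∎

  G-determined-by-affinePoints : ∀ k k′ → affinePoints f k ≡ affinePoints f k′ → G f k ≡ G f k′
  G-determined-by-affinePoints k k′ eq =
    ℤ-cancelˡ (ℤ.+ List.length (nonzeroF n)) _ _ (trans (sym (affinePoints-G k)) (trans (cong ℤ.+_ eq) (affinePoints-G k′)))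

affinePoints-from-traceTerm : ∀ ff k k′ j → traceTerm ff k j ≡ traceTerm ff k′ j →
                              affinePoints (proj₁ ff j) k ≡ affinePoints (proj₁ ff j) k′
affinePoints-from-traceTerm ff k k′ j eq =
  ℕP.+-cancelʳ-≡ 2 _ _ (ℤP.+-injective (ℤ-cancelʳ (ℤ.- 1ℤ) _ _ (ℤ-cancelʳ (ℤ.- ℤ.+ (2 ℕ.^ suc j)) _ _ eq)))

open PowerSeries using (traceTerm-agree)

theorem19 : (ff : FieldFamily) (k : ℕ) → 1 ≤ k →
    (r : ℕ) (ps : Fin r → ℕ) →
    Injective _≡_ _≡_ ps →
    (∀ i → Prime (ps i)) →
    (∀ i → ps i ∣ k) →
    (∀ p → Prime p → p ∣ k → ∃ λ i → ps i ≡ p) →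
    (Lk L1 : Poly) → IsLPolynomial ff k Lk → IsLPolynomial ff 1 L1 →
    (qs : Fin r → Poly) →
    Lk ≈P mulP (prodFin (λ i → expand (ps i) (qs i))) L1 →
    ∀ n → gcd k (suc n) ≡ 1 →
    G (proj₁ ff n) k ≡ G (proj₁ ff n) 1
theorem19 ff@(fam , isField) k _ r ps _ ps-prime ps∣k _ Lk L1 isLk isL1 qs Lk≈QL1 n gcd≡1 =
  G-determined-by-affinePoints (fam n) (isField n) k 1
    (affinePoints-from-traceTerm ff k 1 n
      (traceTerm-agree ff k ps qs Lk L1 (prime⇒nonZero ∘ ps-prime) isLk isL1 Lk≈QL1 n ps∤m))
  where
  ps∤m : ∀ i → ¬ ps i ∣ suc n
  ps∤m i p∣m = ¬prime[1] (subst Prime (∣1⇒≡1 (subst (ps i ∣_) gcd≡1 (gcd-greatest (ps∣k i) p∣m))) (ps-prime i))
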